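{- Let $p$ and $q$ be distinct primes and $n = pq$. Then the Laplacian eigenvalues of the cozero-divisor graph $\Gamma'(\mathbb{Z}_n)$ are $0$ with multiplicity $1$, $p+q-2$ with multiplicity $1$, $p-1$ with multiplicity $q-2$, and $q-1$ with multiplicity $p-2$. In particular, $\Gamma'(\mathbb{Z}_{pq})$ is Laplacian integral.
   Context: The cozero-divisor graph $\Gamma'(R)$ of a commutative ring $R$ with unity is the simple undirected graph whose vertices are the non-zero non-unit elements of $R$, with distinct $x,y$ adjacent iff $x \notin Ry$ and $y \notin Rx$. The Laplacian eigenvalues of a graph are the eigenvalues of $D - A$ (degree diagonal matrix minus adjacency matrix). A graph is Laplacian integral if all its Laplacian eigenvalues are integers. -}

module Defs where

open import Data.Nat as ℕ using (ℕ; zero; suc; NonZero; _%_)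
open import Data.Nat.Properties using (m*n≢0)
open import Data.Nat.Primality using (Prime; prime⇒nonZero)
open import Data.Integer as ℤ using (ℤ; +_; -_; _-_)
open import Data.Fin using (Fin; toℕ; punchIn) renaming (zero to fz; suc to fs)
open import Data.Fin.Properties using (any?) renaming (_≟_ to _≟F_)
open import Data.List using (List; []; _∷_; filter; length; lookup; map)
open import Data.List.Base using ()
open import Data.Fin.Base using ()
open import Data.Product using (∃; _×_; _,_)
open import Relation.Nullary using (¬_; Dec; yes; no)
open import Relation.Nullary.Decidable using (¬?; _×-dec_)
open import Relation.Binary.PropositionalEquality using (_≡_; _≢_)
import Data.Nat.Base as NB
open import Data.List using (allFin)

nonZeroPQ : ∀ {p q} → Prime p → Prime q → NonZero (p ℕ.* q)
nonZeroPQ {p} {q} pp qp = m*n≢0 p q {{prime⇒nonZero pp}} {{prime⇒nonZero qp}}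

module ZMod (n : ℕ) .{{_ : NonZero n}} where

  _·_ : Fin n → Fin n → ℕ
  a · b = (toℕ a ℕ.* toℕ b) % n

  IsZero : Fin n → Set
  IsZero x = toℕ x ≡ 0

  IsUnit : Fin n → Set
  IsUnit x = ∃ λ (y : Fin n) → x · y ≡ 1 % n

  InIdeal : Fin n → Fin n → Set
  InIdeal x y = ∃ λ (r : Fin n) → r · y ≡ toℕ x

  IsVertex : Fin n → Set
  IsVertex x = ¬ IsZero x × ¬ IsUnit x

  Adj : Fin n → Fin n → Set
  Adj x y = x ≢ y × ¬ InIdeal x y × ¬ InIdeal y x

  isVertex? : (x : Fin n) → Dec (IsVertex x)
  isVertex? x = ¬? (toℕ x ℕ.≟ 0) ×-dec ¬? (any? λ y → (x · y) ℕ.≟ (1 % n))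

  inIdeal? : (x y : Fin n) → Dec (InIdeal x y)
  inIdeal? x y = any? λ r → (r · y) ℕ.≟ toℕ x

  adj? : (x y : Fin n) → Dec (Adj x y)
  adj? x y = ¬? (x ≟F y) ×-dec ¬? (inIdeal? x y) ×-dec ¬? (inIdeal? y x)

  vertices : List (Fin n)
  vertices = filter isVertex? (allFin n)

  N : ℕ
  N = length vertices

  vtx : Fin N → Fin n
  vtx = lookup vertices

  degree : Fin N → ℕ
  degree i = length (filter (λ j → adj? (vtx i) (vtx j)) (allFin N))

  laplacian : Fin N → Fin N → ℤ
  laplacian i j with i ≟F j
  ... | yes _ = + degree i
  ... | no _ with adj? (vtx i) (vtx j)
  ...   | yes _ = - (+ 1)
  ...   | no _ = + 0

∑ : ∀ {m} → (Fin m → ℤ) → ℤ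
∑ {zero} f = + 0
∑ {suc m} f = f fz ℤ.+ ∑ (λ i → f (fs i))

sign : ∀ {m} → Fin m → ℤ
sign i = (- (+ 1)) ℤ.^ toℕ i

det : ∀ {m} → (Fin m → Fin m → ℤ) → ℤ
det {zero} M = + 1
det {suc m} M = ∑ λ j → sign j ℤ.* M fz j ℤ.* det (λ a b → M (fs a) (punchIn j b))

charPoly : ∀ {m} → (Fin m → Fin m → ℤ) → ℤ → ℤ
charPoly M t = det λ i j → (δ i j) - M i j
  where
  δ : _ → _ → ℤ
  δ i j with i ≟F j
  ... | yes _ = t
  ... | no _ = + 0

∏ : List ℤ → ℤ
∏ [] = + 1
∏ (x ∷ xs) = x ℤ.* ∏ xs

-- all eigenvalues (counted with multiplicity) are integers:
-- the characteristic polynomial splits into linear factors over ℤ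
AllEigenvaluesIntegral : ∀ {m} → (Fin m → Fin m → ℤ) → Set
AllEigenvaluesIntegral {m} M =
  ∃ λ (ls : List ℤ) → length ls ≡ m × (∀ t → charPoly M t ≡ ∏ (map (λ l → t - l) ls))

LaplacianZ : (n : ℕ) .{{_ : NonZero n}} → Fin (ZMod.N n) → Fin (ZMod.N n) → ℤ
LaplacianZ n = ZMod.laplacian n

LaplacianIntegral : (n : ℕ) .{{_ : NonZero n}} → Set
LaplacianIntegral n = AllEigenvaluesIntegral (LaplacianZ n)

{-# OPTIONS --safe #-}
-- The non-zero non-units of ℤ_pq are the residues divisible by exactly one of p and q: q − 1 multiples of p
-- and p − 1 multiples of q. Two multiples of the same prime generate the same ideal, while multiples of
-- different primes do not divide each other, so Γ′(ℤ_pq) is the complete bipartite graph K_{q−1,p−1}. Its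
-- matrix tI − L has diagonal t − (size of the other class), entries 1 between the classes and 0 within them.
-- Such two-class matrices have determinant x^k y^m − W V x^(k−1) y^(m−1) (k, m the class sizes, W, V the
-- summed row weights of the classes, x, y their diagonal values), proved by induction on the size using column
-- operations and expansion along the first row. For k = q − 1 and m = p − 1 this factors as
-- t (t − (p + q − 2)) (t − (p − 1))^(q−2) (t − (q − 1))^(p−2).
module Submission where

open import Defs
open import Data.Nat.Base using (ℕ)
open import Data.Nat.Primality using (Prime)
open import Relation.Binary.PropositionalEquality using (_≢_)

module Determinant where
  open import Data.Nat as ℕ using (ℕ; zero; suc; z≤n)
  import Data.Nat.Properties as ℕₚ
  open import Data.Integer using (ℤ; 0ℤ; 1ℤ; -_; _+_; _*_; _-_; _^_)
  import Data.Integer.Properties as ℤₚ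
  open import Data.Integer.Tactic.RingSolver using (solve-∀)
  open import Data.Fin using (Fin; toℕ; punchIn; punchOut; inject₁; fromℕ<) renaming (zero to fz; suc to fs)
  open import Data.Fin.Properties
    using (suc-injective; toℕ-injective; toℕ-inject₁; toℕ-fromℕ<; toℕ<n; punchIn-injective; punchInᵢ≢i; punchIn-punchOut)
    renaming (_≟_ to _≟ᶠ_)
  open import Data.Empty using (⊥-elim)
  open import Data.Sum using (_⊎_; inj₁; inj₂)
  open import Data.Product using (_×_; _,_)
  open import Data.Vec.Functional using (updateAt)
  open import Data.Vec.Functional.Properties using (updateAt-updates; updateAt-minimal)
  open import Function using (_∘_; const)
  open import Relation.Nullary using (yes; no)
  open import Relation.Binary.PropositionalEquality
  open import Relation.Binary.Definitions using (tri<; tri≈; tri>)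

  Mat : ℕ → Set
  Mat n = Fin n → Fin n → ℤ

  minor : ∀ {n} → Mat (suc n) → Fin (suc n) → Mat n
  minor M j a b = M (fs a) (punchIn j b)

  ∑-cong : ∀ {m} {f g : Fin m → ℤ} → (∀ i → f i ≡ g i) → ∑ f ≡ ∑ g
  ∑-cong {zero} f≗g = refl
  ∑-cong {suc m} f≗g = cong₂ _+_ (f≗g fz) (∑-cong (f≗g ∘ fs))

  ∑-distrib-+ : ∀ {m} (f g : Fin m → ℤ) → ∑ (λ i → f i + g i) ≡ ∑ f + ∑ g
  ∑-distrib-+ {zero} f g = refl
  ∑-distrib-+ {suc m} f g =
    trans (cong (f fz + g fz +_) (∑-distrib-+ (f ∘ fs) (g ∘ fs))) (interchange (f fz) (g fz) _ _)
    where
    interchange : ∀ a b c d → a + b + (c + d) ≡ a + c + (b + d)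
    interchange = solve-∀

  *-distribˡ-∑ : ∀ {m} a (f : Fin m → ℤ) → a * ∑ f ≡ ∑ (λ i → a * f i)
  *-distribˡ-∑ {zero} a f = ℤₚ.*-zeroʳ a
  *-distribˡ-∑ {suc m} a f = trans (ℤₚ.*-distribˡ-+ a (f fz) _) (cong (a * f fz +_) (*-distribˡ-∑ a (f ∘ fs)))

  ∑-zero : ∀ {m} (f : Fin m → ℤ) → (∀ i → f i ≡ 0ℤ) → ∑ f ≡ 0ℤ
  ∑-zero {zero} f f≗0 = refl
  ∑-zero {suc m} f f≗0 = cong₂ _+_ (f≗0 fz) (∑-zero (f ∘ fs) (f≗0 ∘ fs))

  ∑-single : ∀ {m} (f : Fin m → ℤ) l → (∀ i → i ≢ l → f i ≡ 0ℤ) → ∑ f ≡ f l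
  ∑-single f fz rest = trans (cong (f fz +_) (∑-zero (f ∘ fs) (λ i → rest (fs i) λ ()))) (ℤₚ.+-identityʳ _)
  ∑-single f (fs l) rest =
    trans (cong₂ _+_ (rest fz λ ()) (∑-single (f ∘ fs) l λ i i≢l → rest (fs i) (i≢l ∘ suc-injective))) (ℤₚ.+-identityˡ _)

  ∑-pair : ∀ {m} (f : Fin m → ℤ) a b → a ≢ b → (∀ i → i ≢ a → i ≢ b → f i ≡ 0ℤ) → ∑ f ≡ f a + f b
  ∑-pair f fz fz a≢b rest = ⊥-elim (a≢b refl)
  ∑-pair f fz (fs b) a≢b rest =
    cong (f fz +_) (∑-single (f ∘ fs) b λ i i≢b → rest (fs i) (λ ()) (i≢b ∘ suc-injective))
  ∑-pair f (fs a) fz a≢b rest =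
    trans (cong (f fz +_) (∑-single (f ∘ fs) a λ i i≢a → rest (fs i) (i≢a ∘ suc-injective) (λ ()))) (ℤₚ.+-comm (f fz) _)
  ∑-pair f (fs a) (fs b) a≢b rest =
    trans (cong₂ _+_ (rest fz (λ ()) (λ ()))
                     (∑-pair (f ∘ fs) a b (a≢b ∘ cong fs) λ i i≢a i≢b →
                        rest (fs i) (i≢a ∘ suc-injective) (i≢b ∘ suc-injective)))
          (ℤₚ.+-identityˡ _)

  det-cong : ∀ {n} {A B : Mat n} → (∀ i j → A i j ≡ B i j) → det A ≡ det B
  det-cong {zero} A≗B = refl
  det-cong {suc n} A≗B = ∑-cong λ j → cong₂ _*_ (cong (sign j *_) (A≗B fz j)) (det-cong λ a b → A≗B (fs a) (punchIn j b))

  laplaceTerm : ∀ {n} → Mat (suc n) → Fin (suc n) → ℤ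
  laplaceTerm M j = sign j * M fz j * det (minor M j)

  det-linear-terms : ∀ {n} (a b : ℤ) (M A B : Mat (suc n)) →
    (∀ j → laplaceTerm M j ≡ a * laplaceTerm A j + b * laplaceTerm B j) → det M ≡ a * det A + b * det B
  det-linear-terms a b M A B terms = begin
    ∑ (laplaceTerm M)                                              ≡⟨ ∑-cong terms ⟩
    ∑ (λ j → a * laplaceTerm A j + b * laplaceTerm B j)            ≡⟨ ∑-distrib-+ (λ j → a * laplaceTerm A j) (λ j → b * laplaceTerm B j) ⟩
    ∑ (λ j → a * laplaceTerm A j) + ∑ (λ j → b * laplaceTerm B j)
      ≡⟨ sym (cong₂ _+_ (*-distribˡ-∑ a (laplaceTerm A)) (*-distribˡ-∑ b (laplaceTerm B))) ⟩
    a * det A + b * det B                                          ∎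
    where open ≡-Reasoning

  laplaceTerm-linear-entry : ∀ {n} (a b : ℤ) (M A B : Mat (suc n)) j → M fz j ≡ a * A fz j + b * B fz j →
    det (minor M j) ≡ det (minor A j) → det (minor M j) ≡ det (minor B j) →
    laplaceTerm M j ≡ a * laplaceTerm A j + b * laplaceTerm B j
  laplaceTerm-linear-entry a b M A B j entry minor-A minor-B =
    trans (cong (λ z → sign j * z * det (minor M j)) entry)
          (trans (pull-out a b (sign j) (A fz j) (B fz j) (det (minor M j)))
                 (cong₂ (λ u v → a * (sign j * A fz j * u) + b * (sign j * B fz j * v)) minor-A minor-B))
    where
    pull-out : ∀ a b s x y d → s * (a * x + b * y) * d ≡ a * (s * x * d) + b * (s * y * d)
    pull-out = solve-∀

  laplaceTerm-linear-minor : ∀ {n} (a b : ℤ) (M A B : Mat (suc n)) j → M fz j ≡ A fz j → M fz j ≡ B fz j →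
    det (minor M j) ≡ a * det (minor A j) + b * det (minor B j) →
    laplaceTerm M j ≡ a * laplaceTerm A j + b * laplaceTerm B j
  laplaceTerm-linear-minor a b M A B j entry-A entry-B minors =
    trans (cong (sign j * M fz j *_) minors)
          (trans (pull-in a b (sign j) (M fz j) (det (minor A j)) (det (minor B j)))
                 (cong₂ (λ u v → a * (sign j * u * det (minor A j)) + b * (sign j * v * det (minor B j))) entry-A entry-B))
    where
    pull-in : ∀ a b s x d e → s * x * (a * d + b * e) ≡ a * (s * x * d) + b * (s * x * e)
    pull-in = solve-∀

  det-linear-column : ∀ {n} (l : Fin n) (a b : ℤ) (M A B : Mat n) →
    (∀ i j → j ≢ l → M i j ≡ A i j) → (∀ i j → j ≢ l → M i j ≡ B i j) →
    (∀ i → M i l ≡ a * A i l + b * B i l) → det M ≡ a * det A + b * det B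
  det-linear-column {suc n} l a b M A B M≈A M≈B Mₗ = det-linear-terms a b M A B term
    where
    term : ∀ j → laplaceTerm M j ≡ a * laplaceTerm A j + b * laplaceTerm B j
    term j with j ≟ᶠ l
    ... | yes refl = laplaceTerm-linear-entry a b M A B j (Mₗ fz) (minor≈ M≈A) (minor≈ M≈B)
      where
      minor≈ : ∀ {X} → (∀ i k → k ≢ j → M i k ≡ X i k) → det (minor M j) ≡ det (minor X j)
      minor≈ M≈X = det-cong λ x y → M≈X (fs x) (punchIn j y) (punchInᵢ≢i j y)
    ... | no j≢l = laplaceTerm-linear-minor a b M A B j (M≈A fz j j≢l) (M≈B fz j j≢l)
      (det-linear-column l′ a b (minor M j) (minor A j) (minor B j)
        (λ x y y≢l′ → M≈A (fs x) (punchIn j y) (away y≢l′))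
        (λ x y y≢l′ → M≈B (fs x) (punchIn j y) (away y≢l′))
        (λ x → trans (cong (M (fs x)) l≡) (trans (Mₗ (fs x)) (cong₂ (λ u v → a * A (fs x) u + b * B (fs x) v) (sym l≡) (sym l≡)))))
      where
      l′ = punchOut j≢l
      l≡ : punchIn j l′ ≡ l
      l≡ = punchIn-punchOut j≢l
      away : ∀ {y} → y ≢ l′ → punchIn j y ≢ l
      away y≢l′ e = y≢l′ (punchIn-injective j _ l′ (trans e (sym l≡)))

  det-linear-row₀ : ∀ {n} (a b : ℤ) (M A B : Mat (suc n)) →
    (∀ x j → M (fs x) j ≡ A (fs x) j) → (∀ x j → M (fs x) j ≡ B (fs x) j) →
    (∀ j → M fz j ≡ a * A fz j + b * B fz j) → det M ≡ a * det A + b * det B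
  det-linear-row₀ a b M A B M≈A M≈B M₀ = det-linear-terms a b M A B λ j →
    laplaceTerm-linear-entry a b M A B j (M₀ j) (det-cong λ x y → M≈A x (punchIn j y)) (det-cong λ x y → M≈B x (punchIn j y))

  det-scale-column : ∀ {n} (l : Fin n) (a : ℤ) (M A : Mat n) →
    (∀ i j → j ≢ l → M i j ≡ A i j) → (∀ i → M i l ≡ a * A i l) → det M ≡ a * det A
  det-scale-column l a M A M≈A Mₗ =
    trans (det-linear-column l a 0ℤ M A A M≈A M≈A λ i → trans (Mₗ i) (sym (ℤₚ.+-identityʳ _)))
          (ℤₚ.+-identityʳ _)

  det-additive-column : ∀ {n} (l : Fin n) (M A B : Mat n) →
    (∀ i j → j ≢ l → M i j ≡ A i j) → (∀ i j → j ≢ l → M i j ≡ B i j) →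
    (∀ i → M i l ≡ A i l + B i l) → det M ≡ det A + det B
  det-additive-column l M A B M≈A M≈B Mₗ =
    trans (det-linear-column l 1ℤ 1ℤ M A B M≈A M≈B λ i →
             trans (Mₗ i) (sym (cong₂ _+_ (ℤₚ.*-identityˡ (A i l)) (ℤₚ.*-identityˡ (B i l)))))
          (cong₂ _+_ (ℤₚ.*-identityˡ (det A)) (ℤₚ.*-identityˡ (det B)))

  det-row₀-single : ∀ {n} (M : Mat (suc n)) l → (∀ j → j ≢ l → M fz j ≡ 0ℤ) → det M ≡ laplaceTerm M l
  det-row₀-single M l row₀ = ∑-single (laplaceTerm M) l λ j j≢l →
    trans (cong (λ z → sign j * z * det (minor M j)) (row₀ j j≢l))
          (trans (cong (_* det (minor M j)) (ℤₚ.*-zeroʳ (sign j))) (ℤₚ.*-zeroˡ (det (minor M j))))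

  data Adjacent : ∀ {n} → Fin n → Fin n → Set where
    zero-one : ∀ {n} → Adjacent {suc (suc n)} fz (fs fz)
    suc-suc  : ∀ {n} {a b : Fin n} → Adjacent a b → Adjacent (fs a) (fs b)

  toℕ-adjacent : ∀ {n} {a b : Fin n} → Adjacent a b → toℕ b ≡ suc (toℕ a)
  toℕ-adjacent zero-one = refl
  toℕ-adjacent (suc-suc adj) = cong suc (toℕ-adjacent adj)

  adjacent : ∀ {n} {a b : Fin n} → toℕ b ≡ suc (toℕ a) → Adjacent a b
  adjacent {a = fz} {fs fz} refl = zero-one
  adjacent {a = fs a} {fs b} eq = suc-suc (adjacent (ℕₚ.suc-injective eq))

  adjacent⇒≢ : ∀ {n} {a b : Fin n} → Adjacent a b → a ≢ b
  adjacent⇒≢ (suc-suc adj) refl = adjacent⇒≢ adj refl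

  punchOut-adjacent : ∀ {n} {a b j : Fin (suc n)} → Adjacent a b → (j≢a : j ≢ a) (j≢b : j ≢ b) →
    Adjacent (punchOut j≢a) (punchOut j≢b)
  punchOut-adjacent {j = fz} zero-one j≢a j≢b = ⊥-elim (j≢a refl)
  punchOut-adjacent {j = fs fz} zero-one j≢a j≢b = ⊥-elim (j≢b refl)
  punchOut-adjacent {j = fs (fs fz)} zero-one j≢a j≢b = zero-one
  punchOut-adjacent {j = fs (fs (fs _))} zero-one j≢a j≢b = zero-one
  punchOut-adjacent {j = fz} (suc-suc adj) j≢a j≢b = adj
  punchOut-adjacent {j = fs j} (suc-suc adj@zero-one) j≢a j≢b =
    suc-suc (punchOut-adjacent adj (j≢a ∘ cong fs) (j≢b ∘ cong fs))
  punchOut-adjacent {j = fs j} (suc-suc adj@(suc-suc _)) j≢a j≢b =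
    suc-suc (punchOut-adjacent adj (j≢a ∘ cong fs) (j≢b ∘ cong fs))

  punchIn-adjacent : ∀ {n} {a b : Fin (suc n)} → Adjacent a b → ∀ y →
    punchIn a y ≡ punchIn b y ⊎ (punchIn a y ≡ b × punchIn b y ≡ a)
  punchIn-adjacent zero-one fz = inj₂ (refl , refl)
  punchIn-adjacent zero-one (fs y) = inj₁ refl
  punchIn-adjacent (suc-suc adj) fz = inj₁ refl
  punchIn-adjacent (suc-suc adj) (fs y) with punchIn-adjacent adj y
  ... | inj₁ eq = inj₁ (cong fs eq)
  ... | inj₂ (eq₁ , eq₂) = inj₂ (cong fs eq₁ , cong fs eq₂)

  det-adjacent-equal : ∀ {n} (M : Mat n) {a b} → Adjacent a b → (∀ i → M i a ≡ M i b) → det M ≡ 0ℤ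
  det-adjacent-equal {suc n} M {a} {b} adj cols = trans (∑-pair (laplaceTerm M) a b (adjacent⇒≢ adj) vanish) cancel
    where
    vanish : ∀ j → j ≢ a → j ≢ b → laplaceTerm M j ≡ 0ℤ
    vanish j j≢a j≢b = trans (cong (sign j * M fz j *_) minor≡0) (ℤₚ.*-zeroʳ (sign j * M fz j))
      where
      minor≡0 : det (minor M j) ≡ 0ℤ
      minor≡0 = det-adjacent-equal (minor M j) (punchOut-adjacent adj j≢a j≢b) λ x →
        trans (cong (M (fs x)) (punchIn-punchOut j≢a)) (trans (cols (fs x)) (cong (M (fs x)) (sym (punchIn-punchOut j≢b))))
    sign-b : sign b ≡ - 1ℤ * sign a
    sign-b = cong ((- 1ℤ) ^_) (toℕ-adjacent adj)
    minor-b≡minor-a : det (minor M b) ≡ det (minor M a)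
    minor-b≡minor-a = det-cong λ x y → column x y (punchIn-adjacent adj y)
      where
      column : ∀ x y → punchIn a y ≡ punchIn b y ⊎ (punchIn a y ≡ b × punchIn b y ≡ a) → minor M b x y ≡ minor M a x y
      column x y (inj₁ same) = cong (M (fs x)) (sym same)
      column x y (inj₂ (a↦b , b↦a)) = trans (cong (M (fs x)) b↦a) (trans (cols (fs x)) (cong (M (fs x)) (sym a↦b)))
    opposite : ∀ s x d → s * x * d + - 1ℤ * s * x * d ≡ 0ℤ
    opposite = solve-∀
    cancel : laplaceTerm M a + laplaceTerm M b ≡ 0ℤ
    cancel = trans (cong (laplaceTerm M a +_) (cong₂ (λ s x → s * x * det (minor M b)) sign-b (sym (cols fz))))
                   (trans (cong (λ d → laplaceTerm M a + - 1ℤ * sign a * M fz a * d) minor-b≡minor-a) (opposite (sign a) (M fz a) _))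

  setCol : ∀ {n} → Mat n → Fin n → (Fin n → ℤ) → Mat n
  setCol M l v i = updateAt (M i) l (const (v i))

  setCol-≡ : ∀ {n} (M : Mat n) l v i → setCol M l v i l ≡ v i
  setCol-≡ M l v i = updateAt-updates l (M i)

  setCol-≢ : ∀ {n} (M : Mat n) l v i {j} → j ≢ l → setCol M l v i j ≡ M i j
  setCol-≢ M l v i {j} = updateAt-minimal j l (M i)

  swapCols : ∀ {n} → Mat n → Fin n → Fin n → Mat n
  swapCols M a b = setCol (setCol M a (λ i → M i b)) b (λ i → M i a)

  det-swapCols : ∀ {n} {a b : Fin n} → a ≢ b → (∀ X → (∀ i → X i a ≡ X i b) → det X ≡ 0ℤ) →
    ∀ M → det (swapCols M a b) ≡ - det M
  det-swapCols {n} {a} {b} a≢b alternating M = negated (det M) (D v u) (begin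
    0ℤ                        ≡⟨ sym (D-diag (u ⊕ v)) ⟩
    D (u ⊕ v) (u ⊕ v)         ≡⟨ D-additiveˡ u v (u ⊕ v) ⟩
    D u (u ⊕ v) + D v (u ⊕ v) ≡⟨ cong₂ _+_ (D-additiveʳ u u v) (D-additiveʳ v u v) ⟩
    D u u + D u v + (D v u + D v v)
      ≡⟨ cong₂ (λ x y → x + D u v + (D v u + y)) (D-diag u) (D-diag v) ⟩
    0ℤ + D u v + (D v u + 0ℤ) ≡⟨ cong (λ x → 0ℤ + x + (D v u + 0ℤ)) D-original ⟩
    0ℤ + det M + (D v u + 0ℤ) ∎)
    where
    open ≡-Reasoning
    u v : Fin n → ℤ
    u i = M i a
    v i = M i b
    _⊕_ : (Fin n → ℤ) → (Fin n → ℤ) → Fin n → ℤ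
    (x ⊕ y) i = x i + y i
    S : (Fin n → ℤ) → (Fin n → ℤ) → Mat n
    S x y = setCol (setCol M a x) b y
    D : (Fin n → ℤ) → (Fin n → ℤ) → ℤ
    D x y = det (S x y)
    S-a : ∀ x y i → S x y i a ≡ x i
    S-a x y i = trans (setCol-≢ (setCol M a x) b y i a≢b) (setCol-≡ M a x i)
    S-b : ∀ x y i → S x y i b ≡ y i
    S-b x y i = setCol-≡ (setCol M a x) b y i
    S-elsewhere : ∀ x y i {j} → j ≢ a → j ≢ b → S x y i j ≡ M i j
    S-elsewhere x y i j≢a j≢b = trans (setCol-≢ (setCol M a x) b y i j≢b) (setCol-≢ M a x i j≢a)
    S-away-a : ∀ x x′ y i j → j ≢ a → S x y i j ≡ S x′ y i j
    S-away-a x x′ y i j j≢a with j ≟ᶠ b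
    ... | yes refl = trans (S-b x y i) (sym (S-b x′ y i))
    ... | no j≢b = trans (S-elsewhere x y i j≢a j≢b) (sym (S-elsewhere x′ y i j≢a j≢b))
    S-away-b : ∀ x y y′ i j → j ≢ b → S x y i j ≡ S x y′ i j
    S-away-b x y y′ i j j≢b with j ≟ᶠ a
    ... | yes refl = trans (S-a x y i) (sym (S-a x y′ i))
    ... | no j≢a = trans (S-elsewhere x y i j≢a j≢b) (sym (S-elsewhere x y′ i j≢a j≢b))
    D-diag : ∀ x → D x x ≡ 0ℤ
    D-diag x = alternating (S x x) λ i → trans (S-a x x i) (sym (S-b x x i))
    D-additiveˡ : ∀ x x′ y → D (x ⊕ x′) y ≡ D x y + D x′ y
    D-additiveˡ x x′ y = det-additive-column a (S (x ⊕ x′) y) (S x y) (S x′ y) (S-away-a (x ⊕ x′) x y) (S-away-a (x ⊕ x′) x′ y)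
      λ i → trans (S-a (x ⊕ x′) y i) (sym (cong₂ _+_ (S-a x y i) (S-a x′ y i)))
    D-additiveʳ : ∀ x y y′ → D x (y ⊕ y′) ≡ D x y + D x y′
    D-additiveʳ x y y′ = det-additive-column b (S x (y ⊕ y′)) (S x y) (S x y′) (S-away-b x (y ⊕ y′) y) (S-away-b x (y ⊕ y′) y′)
      λ i → trans (S-b x (y ⊕ y′) i) (sym (cong₂ _+_ (S-b x y i) (S-b x y′ i)))
    D-original : D u v ≡ det M
    D-original = det-cong entry
      where
      entry : ∀ i j → S u v i j ≡ M i j
      entry i j with j ≟ᶠ a | j ≟ᶠ b
      ... | yes refl | _ = S-a u v i
      ... | no _ | yes refl = S-b u v i
      ... | no j≢a | no j≢b = S-elsewhere u v i j≢a j≢b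
    negated : ∀ m s → 0ℤ ≡ 0ℤ + m + (s + 0ℤ) → s ≡ - m
    negated m s eq = begin
      s                       ≡⟨ rearrange m s ⟩
      0ℤ + m + (s + 0ℤ) + - m ≡⟨ cong (_+ - m) (sym eq) ⟩
      0ℤ + - m                ≡⟨ ℤₚ.+-identityˡ (- m) ⟩
      - m                     ∎
      where
      rearrange : ∀ m s → s ≡ 0ℤ + m + (s + 0ℤ) + - m
      rearrange = solve-∀

  det-equal-columns-at-distance : ∀ d {n} (M : Mat n) (a b : Fin n) → toℕ b ≡ suc (d ℕ.+ toℕ a) →
    (∀ i → M i a ≡ M i b) → det M ≡ 0ℤ
  det-equal-columns-at-distance zero M a b b≡a+1 cols = det-adjacent-equal M (adjacent b≡a+1) cols
  det-equal-columns-at-distance (suc d) M a (fs b₀) b≡a+d+2 cols =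
    -≡0 (trans (sym (det-swapCols (adjacent⇒≢ b′~b) (λ X → det-adjacent-equal X b′~b) M))
               (det-equal-columns-at-distance d (swapCols M b′ (fs b₀)) a b′ b′≡a+d+1 swapped-cols))
    where
    b′ = inject₁ b₀
    b′≡a+d+1 : toℕ b′ ≡ suc (d ℕ.+ toℕ a)
    b′≡a+d+1 = trans (toℕ-inject₁ b₀) (ℕₚ.suc-injective b≡a+d+2)
    b′~b : Adjacent b′ (fs b₀)
    b′~b = adjacent (cong suc (sym (toℕ-inject₁ b₀)))
    a≢ : ∀ {c} d′ → toℕ c ≡ suc (d′ ℕ.+ toℕ a) → a ≢ c
    a≢ d′ c≡ refl = ℕₚ.m≢1+n+m (toℕ a) c≡
    inner : Mat _
    inner = setCol M b′ (λ i → M i (fs b₀))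
    swapped-cols : ∀ i → swapCols M b′ (fs b₀) i a ≡ swapCols M b′ (fs b₀) i b′
    swapped-cols i = begin
      swapCols M b′ (fs b₀) i a  ≡⟨ setCol-≢ inner (fs b₀) (λ i → M i b′) i (a≢ (suc d) b≡a+d+2) ⟩
      inner i a                  ≡⟨ setCol-≢ M b′ (λ i → M i (fs b₀)) i (a≢ d b′≡a+d+1) ⟩
      M i a                      ≡⟨ cols i ⟩
      M i (fs b₀)                ≡⟨ sym (setCol-≡ M b′ (λ i → M i (fs b₀)) i) ⟩
      inner i b′                 ≡⟨ sym (setCol-≢ inner (fs b₀) (λ i → M i b′) i (adjacent⇒≢ b′~b)) ⟩
      swapCols M b′ (fs b₀) i b′ ∎
      where open ≡-Reasoning
    -≡0 : ∀ {x} → - x ≡ 0ℤ → x ≡ 0ℤ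
    -≡0 {x} -x≡0 = trans (sym (ℤₚ.neg-involutive x)) (cong -_ -x≡0)

  distance : ∀ {x y : ℕ} → x ℕ.< y → y ≡ suc ((y ℕ.∸ suc x) ℕ.+ x)
  distance {x} {y} x<y = sym (trans (sym (ℕₚ.+-suc _ x)) (ℕₚ.m∸n+n≡m x<y))

  det-equal-columns : ∀ {n} (M : Mat n) {a b} → a ≢ b → (∀ i → M i a ≡ M i b) → det M ≡ 0ℤ
  det-equal-columns M {a} {b} a≢b cols with ℕₚ.<-cmp (toℕ a) (toℕ b)
  ... | tri< a<b _ _ = det-equal-columns-at-distance _ M a b (distance a<b) cols
  ... | tri≈ _ a≡b _ = ⊥-elim (a≢b (toℕ-injective a≡b))
  ... | tri> _ _ b<a = det-equal-columns-at-distance _ M b a (distance b<a) (sym ∘ cols)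

  det-add-column : ∀ {n} (M : Mat n) {l m} → l ≢ m → ∀ c → det (setCol M l (λ i → M i l + c * M i m)) ≡ det M
  det-add-column M {l} {m} l≢m c = begin
    det (setCol M l added)     ≡⟨ det-linear-column l 1ℤ c _ M copy
                                    (λ i j → setCol-≢ M l added i)
                                    (λ i j j≢l → trans (setCol-≢ M l added i j≢l) (sym (setCol-≢ M l colₘ i j≢l)))
                                    column-l ⟩
    1ℤ * det M + c * det copy  ≡⟨ cong (λ z → 1ℤ * det M + c * z) (det-equal-columns copy l≢m duplicate) ⟩
    1ℤ * det M + c * 0ℤ        ≡⟨ simplify (det M) c ⟩
    det M                      ∎
    where
    open ≡-Reasoning
    added colₘ : _ → ℤ
    added i = M i l + c * M i m
    colₘ i = M i m
    copy : Mat _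
    copy = setCol M l colₘ
    column-l : ∀ i → setCol M l added i l ≡ 1ℤ * M i l + c * copy i l
    column-l i = trans (setCol-≡ M l added i)
                       (cong₂ (λ x y → x + c * y) (sym (ℤₚ.*-identityˡ (M i l))) (sym (setCol-≡ M l colₘ i)))
    duplicate : ∀ i → copy i l ≡ copy i m
    duplicate i = trans (setCol-≡ M l colₘ i) (sym (setCol-≢ M l colₘ i (l≢m ∘ sym)))
    simplify : ∀ d c → 1ℤ * d + c * 0ℤ ≡ d
    simplify = solve-∀

  addToColumns : ∀ {n} → Mat n → Fin n → (Fin n → ℤ) → Mat n
  addToColumns M m c i j = M i j + c j * M i m

  det-addToColumns-clear : ∀ {n} (M : Mat n) m (c : Fin n → ℤ) l → c m ≡ 0ℤ →
    det (addToColumns M m c) ≡ det (addToColumns M m (updateAt c l (const 0ℤ)))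
  det-addToColumns-clear M m c l cₘ≡0 with l ≟ᶠ m
  ... | yes refl = det-cong λ i j → cong (λ z → M i j + z * M i m) (unchanged j)
    where
    unchanged : ∀ j → c j ≡ updateAt c l (const 0ℤ) j
    unchanged j with j ≟ᶠ l
    ... | yes refl = trans cₘ≡0 (sym (updateAt-updates l c))
    ... | no j≢l = sym (updateAt-minimal j l c j≢l)
  ... | no l≢m = trans (det-cong entry) (det-add-column X l≢m (c l))
    where
    c′ = updateAt c l (const 0ℤ)
    X = addToColumns M m c′
    Xₘ : ∀ i → X i m ≡ M i m
    Xₘ i = trans (cong (λ z → M i m + z * M i m) (trans (updateAt-minimal m l c (l≢m ∘ sym)) cₘ≡0))
                 (ℤₚ.+-identityʳ (M i m))
    drop-zero : ∀ x y z → x + y * z ≡ x + 0ℤ * z + y * z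
    drop-zero = solve-∀
    added : _ → ℤ
    added i = X i l + c l * X i m
    entry : ∀ i j → addToColumns M m c i j ≡ setCol X l added i j
    entry i j with j ≟ᶠ l
    ... | yes refl = sym (trans (setCol-≡ X j added i)
                        (trans (cong₂ (λ u v → M i j + u * M i m + c j * v) (updateAt-updates j c) (Xₘ i))
                               (sym (drop-zero (M i j) (c j) (M i m)))))
    ... | no j≢l = sym (trans (setCol-≢ X l added i j≢l) (cong (λ z → M i j + z * M i m) (updateAt-minimal j l c j≢l)))

  det-addToColumns : ∀ {n} (M : Mat n) m (c : Fin n → ℤ) → c m ≡ 0ℤ → det (addToColumns M m c) ≡ det M
  det-addToColumns {n} M m c cₘ≡0 = go n c cₘ≡0 λ j n≤j → ⊥-elim (ℕₚ.<⇒≱ (toℕ<n j) n≤j)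
    where
    go : ∀ k c → c m ≡ 0ℤ → (∀ j → k ℕ.≤ toℕ j → c j ≡ 0ℤ) → det (addToColumns M m c) ≡ det M
    go zero c _ c≡0 = det-cong λ i j → trans (cong (λ z → M i j + z * M i m) (c≡0 j z≤n)) (ℤₚ.+-identityʳ (M i j))
    go (suc k) c cₘ≡0 vanish with k ℕ.<? n
    ... | no k≮n = go k c cₘ≡0 λ j k≤j → ⊥-elim (k≮n (ℕₚ.≤-<-trans k≤j (toℕ<n j)))
    ... | yes k<n = trans (det-addToColumns-clear M m c l cₘ≡0) (go k c′ c′ₘ≡0 vanish′)
      where
      l = fromℕ< k<n
      c′ = updateAt c l (const 0ℤ)
      cleared : ∀ {j} → j ≢ l → c j ≡ 0ℤ → c′ j ≡ 0ℤ
      cleared j≢l cⱼ≡0 = trans (updateAt-minimal _ l c j≢l) cⱼ≡0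
      c′ₘ≡0 : c′ m ≡ 0ℤ
      c′ₘ≡0 with m ≟ᶠ l
      ... | yes refl = updateAt-updates l c
      ... | no m≢l = cleared m≢l cₘ≡0
      vanish′ : ∀ j → k ℕ.≤ toℕ j → c′ j ≡ 0ℤ
      vanish′ j k≤j with j ≟ᶠ l
      ... | yes refl = updateAt-updates l c
      ... | no j≢l = cleared j≢l (vanish j (ℕₚ.≤∧≢⇒< k≤j λ k≡j →
                       j≢l (toℕ-injective (trans (sym k≡j) (sym (toℕ-fromℕ< k<n))))))

  scalarMat : ∀ {n} → ℤ → Mat n
  scalarMat t i j with i ≟ᶠ j
  ... | yes _ = t
  ... | no _ = 0ℤ

  scalarMat-diag : ∀ {n} t (i : Fin n) → scalarMat t i i ≡ t
  scalarMat-diag t i with i ≟ᶠ i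
  ... | yes _ = refl
  ... | no i≢i = ⊥-elim (i≢i refl)

  scalarMat-off : ∀ {n} t {i j : Fin n} → i ≢ j → scalarMat t i j ≡ 0ℤ
  scalarMat-off t {i} {j} i≢j with i ≟ᶠ j
  ... | yes i≡j = ⊥-elim (i≢j i≡j)
  ... | no _ = refl

  mutual
    charPoly-scalarMat : ∀ {n} (M : Mat n) t → charPoly M t ≡ det (λ i j → scalarMat t i j - M i j)
    charPoly-scalarMat M t = det-cong (charPoly-entry M t)

    -- The left-hand side is the entry of the matrix inside charPoly, whose diagonal helper is local to
    -- Defs; it is found by unification with the use above, hence the mutual block.
    private
      charPoly-entry : ∀ {n} (M : Mat n) t i j → _ ≡ scalarMat t i j - M i j
      charPoly-entry M t i j with i ≟ᶠ j
      ... | yes _ = refl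
      ... | no _ = refl

module Counting where
  open import Data.Nat
  open import Data.Nat.Properties using (+-assoc; <⇒≱; *-zeroʳ; *-suc)
  open import Data.Nat.Divisibility using (_∣?_; ∣-refl; _∣0; ∣m∣n⇒∣m+n; ∣m+n∣m⇒∣n; ∣⇒≤)
  open import Data.Bool using (Bool; true; false; not; if_then_else_; _∧_)
  open import Data.Fin using (Fin; toℕ) renaming (zero to fz; suc to fs)
  open import Data.List using (filter; length; lookup; tabulate)
  open import Function using (_∘_)
  open import Relation.Nullary using (does)
  open import Relation.Nullary.Decidable using (dec-true; dec-false; does-⇔)
  open import Function.Bundles using (mk⇔)
  open import Relation.Unary using (Pred; Decidable)
  open import Relation.Binary.PropositionalEquality

  count : ∀ {n} → (Fin n → Bool) → ℕ
  count {zero} g = 0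
  count {suc n} g = (if g fz then 1 else 0) + count (g ∘ fs)

  count-cong : ∀ {n} {f g : Fin n → Bool} → (∀ i → f i ≡ g i) → count f ≡ count g
  count-cong {zero} f≗g = refl
  count-cong {suc n} f≗g = cong₂ _+_ (cong (λ e → if e then 1 else 0) (f≗g fz)) (count-cong (f≗g ∘ fs))

  module _ {a p} {A : Set a} {P : Pred A p} (P? : Decidable P) where

    length-filter-tabulate : ∀ {n} (f : Fin n → A) → length (filter P? (tabulate f)) ≡ count (λ i → does (P? (f i)))
    length-filter-tabulate {zero} f = refl
    length-filter-tabulate {suc n} f with does (P? (f fz))
    ... | true = cong suc (length-filter-tabulate (f ∘ fs))
    ... | false = length-filter-tabulate (f ∘ fs)

    count-lookup-filter : ∀ {n} (g : A → Bool) (f : Fin n → A) →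
      count (g ∘ lookup (filter P? (tabulate f))) ≡ count (λ i → does (P? (f i)) ∧ g (f i))
    count-lookup-filter {zero} g f = refl
    count-lookup-filter {suc n} g f with does (P? (f fz))
    ... | true = cong ((if g (f fz) then 1 else 0) +_) (count-lookup-filter g (f ∘ fs))
    ... | false = count-lookup-filter g (f ∘ fs)

  countBelow : (ℕ → Bool) → ℕ → ℕ
  countBelow g n = count {n} (g ∘ toℕ)

  countBelow-+ : ∀ m n (g : ℕ → Bool) → countBelow g (m + n) ≡ countBelow g m + countBelow (λ i → g (m + i)) n
  countBelow-+ zero n g = refl
  countBelow-+ (suc m) n g = trans (cong ((if g 0 then 1 else 0) +_) (countBelow-+ m n (g ∘ suc)))
                             (sym (+-assoc (if g 0 then 1 else 0) (countBelow (g ∘ suc) m) (countBelow (λ i → g (suc (m + i))) n)))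

  countBelow-none : ∀ n (g : ℕ → Bool) → (∀ i → i < n → g i ≡ false) → countBelow g n ≡ 0
  countBelow-none zero g none = refl
  countBelow-none (suc n) g none =
    cong₂ _+_ (cong (λ e → if e then 1 else 0) (none 0 z<s)) (countBelow-none n (g ∘ suc) λ i i<n → none (suc i) (s<s i<n))

  countBelow-multiples : ∀ d k .{{_ : NonZero d}} → countBelow (λ i → does (d ∣? i)) (d * k) ≡ k
  countBelow-multiples d zero = cong (countBelow (λ i → does (d ∣? i))) (*-zeroʳ d)
  countBelow-multiples d@(suc d-1) (suc k) = begin
    countBelow multiple (d * suc k)                                        ≡⟨ cong (countBelow multiple) (*-suc d k) ⟩
    countBelow multiple (d + d * k)                                        ≡⟨ countBelow-+ d (d * k) multiple ⟩
    countBelow multiple d + countBelow (λ i → multiple (d + i)) (d * k)    ≡⟨ cong₂ _+_ first-block (count-cong {d * k} shifted) ⟩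
    1 + countBelow multiple (d * k)                                        ≡⟨ cong suc (countBelow-multiples d k) ⟩
    suc k                                                                  ∎
    where
    open ≡-Reasoning
    multiple : ℕ → Bool
    multiple i = does (d ∣? i)
    first-block : countBelow multiple d ≡ 1
    first-block = cong₂ _+_ (cong (λ e → if e then 1 else 0) (dec-true (d ∣? 0) (d ∣0)))
                            (countBelow-none d-1 (multiple ∘ suc) λ i i<d-1 →
                               dec-false (d ∣? suc i) λ d∣1+i → <⇒≱ (s<s i<d-1) (∣⇒≤ d∣1+i))
    shifted : ∀ i → multiple (d + toℕ i) ≡ multiple (toℕ i)
    shifted i = does-⇔ (mk⇔ (λ d∣d+i → ∣m+n∣m⇒∣n d∣d+i ∣-refl) (∣m∣n⇒∣m+n ∣-refl))
                       (d ∣? (d + toℕ i)) (d ∣? toℕ i)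

  countBelow-nonzero : ∀ d n → 0 < n →
    suc (countBelow (λ i → not (does (i ≟ 0)) ∧ does (d ∣? i)) n) ≡ countBelow (λ i → does (d ∣? i)) n
  countBelow-nonzero d (suc m) _ =
    cong (_+ countBelow (λ i → does (d ∣? suc i)) m) (cong (λ e → if e then 1 else 0) (sym (dec-true (d ∣? 0) (d ∣0))))

module TwoClass where
  open Determinant
  open Counting using (count)
  open import Data.Nat as ℕ using (ℕ; zero; suc; _∸_)
  open import Data.Integer using (ℤ; 0ℤ; 1ℤ; -_; _+_; _*_; _-_; _^_)
  import Data.Integer as ℤ using (+_)
  import Data.Nat.Properties as ℕₚ
  import Data.Integer.Properties as ℤₚ
  open import Data.Product using (∃; _,_)
  open import Data.Integer.Tactic.RingSolver using (solve-∀)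
  open import Data.Bool using (Bool; true; false; not; if_then_else_)
  open import Data.Bool.Properties using (not-¬; ¬-not) renaming (_≟_ to _≟ᵇ_)
  open import Data.Fin using (Fin) renaming (zero to fz; suc to fs)
  open import Data.Fin.Properties using (suc-injective; any?) renaming (_≟_ to _≟ᶠ_)
  open import Data.Empty using (⊥-elim)
  open import Function using (_∘_)
  open import Relation.Nullary using (Dec; yes; no; does)
  open import Relation.Nullary.Decidable using (dec-true; dec-false)
  open import Relation.Binary.PropositionalEquality

  -- tI − L of a complete bipartite graph is twoClass c (λ _ → 1ℤ) d; arbitrary row weights w are needed
  -- because the induction in det-twoClass changes them.
  twoClass : ∀ {n} → (Fin n → Bool) → (Fin n → ℤ) → (Bool → ℤ) → Mat n
  twoClass c w d i j with i ≟ᶠ j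
  ... | yes _ = d (c i)
  ... | no _ = if does (c i ≟ᵇ c j) then 0ℤ else w i

  classSize : ∀ {n} → (Fin n → Bool) → Bool → ℕ
  classSize c b = count λ i → does (c i ≟ᵇ b)

  classWeight : ∀ {n} → (Fin n → Bool) → (Fin n → ℤ) → Bool → ℤ
  classWeight c w b = ∑ λ i → if does (c i ≟ᵇ b) then w i else 0ℤ

  -- The truncated k ∸ 1 and m ∸ 1 are harmless: the weight of an empty class is 0.
  bipartiteDet : (k m : ℕ) (W V x y : ℤ) → ℤ
  bipartiteDet k m W V x y = x ^ k * y ^ m - W * V * x ^ (k ∸ 1) * y ^ (m ∸ 1)

  twoClassDet : ∀ {n} → (Fin n → Bool) → (Fin n → ℤ) → (Bool → ℤ) → Bool → ℤ
  twoClassDet c w d b =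
    bipartiteDet (classSize c b) (classSize c (not b)) (classWeight c w b) (classWeight c w (not b)) (d b) (d (not b))

  TwoClassFormula : ℕ → Set
  TwoClassFormula n = ∀ (c : Fin n → Bool) w d b → det (twoClass c w d) ≡ twoClassDet c w d b

  if-same : ∀ {x y} → x ≡ y → ∀ {A : Set} {p q : A} → (if does (x ≟ᵇ y) then p else q) ≡ p
  if-same {x} {y} x≡y = cong (λ e → if e then _ else _) (dec-true (x ≟ᵇ y) x≡y)

  if-other : ∀ {x y} → x ≢ y → ∀ {A : Set} {p q : A} → (if does (x ≟ᵇ y) then p else q) ≡ q
  if-other {x} {y} x≢y = cong (λ e → if e then _ else _) (dec-false (x ≟ᵇ y) x≢y)

  twoClass-diag : ∀ {n} c w d (i : Fin n) → twoClass c w d i i ≡ d (c i)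
  twoClass-diag c w d i with i ≟ᶠ i
  ... | yes _ = refl
  ... | no i≢i = ⊥-elim (i≢i refl)

  twoClass-off : ∀ {n} c w d (i j : Fin n) → i ≢ j → twoClass c w d i j ≡ (if does (c i ≟ᵇ c j) then 0ℤ else w i)
  twoClass-off c w d i j i≢j with i ≟ᶠ j
  ... | yes i≡j = ⊥-elim (i≢j i≡j)
  ... | no _ = refl

  twoClass-same : ∀ {n} c w d (i j : Fin n) → i ≢ j → c i ≡ c j → twoClass c w d i j ≡ 0ℤ
  twoClass-same c w d i j i≢j same = trans (twoClass-off c w d i j i≢j) (if-same same)

  twoClass-other : ∀ {n} c w d (i j : Fin n) → i ≢ j → c i ≢ c j → twoClass c w d i j ≡ w i
  twoClass-other c w d i j i≢j other = trans (twoClass-off c w d i j i≢j) (if-other other)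

  twoClass-suc : ∀ {n} c w d (x y : Fin n) → twoClass c w d (fs x) (fs y) ≡ twoClass (c ∘ fs) (w ∘ fs) d x y
  twoClass-suc c w d x y = by-cases (x ≟ᶠ y)
    where
    by-cases : Dec (x ≡ y) → twoClass c w d (fs x) (fs y) ≡ twoClass (c ∘ fs) (w ∘ fs) d x y
    by-cases (yes refl) = trans (twoClass-diag c w d (fs x)) (sym (twoClass-diag (c ∘ fs) (w ∘ fs) d x))
    by-cases (no x≢y) = trans (twoClass-off c w d (fs x) (fs y) (x≢y ∘ suc-injective)) (sym (twoClass-off (c ∘ fs) (w ∘ fs) d x y x≢y))

  twoClass-weight : ∀ {n} c w w′ d (i j : Fin n) → w i ≡ w′ i → twoClass c w d i j ≡ twoClass c w′ d i j
  twoClass-weight c w w′ d i j wᵢ≡w′ᵢ with i ≟ᶠ j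
  ... | yes _ = refl
  ... | no _ = cong (λ z → if does (c i ≟ᵇ c j) then 0ℤ else z) wᵢ≡w′ᵢ

  classSize-empty : ∀ {n} (c : Fin n → Bool) b → (∀ i → c i ≢ b) → classSize c b ≡ 0
  classSize-empty {zero} c b none = refl
  classSize-empty {suc n} c b none = cong₂ ℕ._+_ (if-other (none fz)) (classSize-empty (c ∘ fs) b (none ∘ fs))

  classSize-full : ∀ {n} (c : Fin n → Bool) b → (∀ i → c i ≡ b) → classSize c b ≡ n
  classSize-full {zero} c b all = refl
  classSize-full {suc n} c b all = cong₂ ℕ._+_ (if-same (all fz)) (classSize-full (c ∘ fs) b (all ∘ fs))

  classSize-total : ∀ {n} (c : Fin n → Bool) → classSize c true ℕ.+ classSize c false ≡ n
  classSize-total {zero} c = refl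
  classSize-total {suc n} c with c fz
  ... | true = cong suc (classSize-total (c ∘ fs))
  ... | false = trans (ℕₚ.+-suc (classSize (c ∘ fs) true) _) (cong suc (classSize-total (c ∘ fs)))

  classWeight-empty : ∀ {n} (c : Fin n → Bool) w b → (∀ i → c i ≢ b) → classWeight c w b ≡ 0ℤ
  classWeight-empty c w b none = ∑-zero _ λ i → if-other (none i)

  classWeight-full : ∀ {n} (c : Fin n → Bool) w b → (∀ i → c i ≡ b) → classWeight c w b ≡ ∑ w
  classWeight-full c w b all = ∑-cong λ i → if-same (all i)

  classSize-nonempty : ∀ {n} (c : Fin n → Bool) b {a} → c a ≡ b → ∃ λ r → classSize c b ≡ suc r
  classSize-nonempty c b {fz} cₐ≡b = classSize (c ∘ fs) b , cong (ℕ._+ classSize (c ∘ fs) b) (if-same cₐ≡b)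
  classSize-nonempty c b {fs a} cₐ≡b with classSize-nonempty (c ∘ fs) b cₐ≡b
  ... | r , size≡ = head ℕ.+ r , trans (cong (head ℕ.+_) size≡) (ℕₚ.+-suc head r)
    where
    head = if does (c fz ≟ᵇ b) then 1 else 0

  classWeight-1 : ∀ {n} (c : Fin n → Bool) b → classWeight c (λ _ → 1ℤ) b ≡ ℤ.+ classSize c b
  classWeight-1 {zero} c b = refl
  classWeight-1 {suc n} c b with does (c fz ≟ᵇ b)
  ... | true = trans (cong (1ℤ +_) (classWeight-1 (c ∘ fs) b)) (sym (ℤₚ.pos-+ 1 (classSize (c ∘ fs) b)))
  ... | false = trans (ℤₚ.+-identityˡ _) (classWeight-1 (c ∘ fs) b)

  δ : ∀ {n} → Fin n → Fin n → ℤ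
  δ a x = if does (x ≟ᶠ a) then 1ℤ else 0ℤ

  δ-≡ : ∀ {n} (a : Fin n) → δ a a ≡ 1ℤ
  δ-≡ a = cong (λ e → if e then 1ℤ else 0ℤ) (dec-true (a ≟ᶠ a) refl)

  δ-≢ : ∀ {n} {a x : Fin n} → x ≢ a → δ a x ≡ 0ℤ
  δ-≢ {a = a} {x} x≢a = cong (λ e → if e then 1ℤ else 0ℤ) (dec-false (x ≟ᶠ a) x≢a)

  classWeight-bump : ∀ {n} (c : Fin n → Bool) w a v b →
    classWeight c (λ x → w x + δ a x * v) b ≡ classWeight c w b + (if does (c a ≟ᵇ b) then v else 0ℤ)
  classWeight-bump c w a v b = begin
    ∑ (λ x → if does (c x ≟ᵇ b) then w x + δ a x * v else 0ℤ) ≡⟨ ∑-cong (λ x → split (does (c x ≟ᵇ b)) (w x) (δ a x * v)) ⟩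
    ∑ (λ x → own x + bump x)                                  ≡⟨ ∑-distrib-+ own bump ⟩
    classWeight c w b + ∑ bump                              ≡⟨ cong (classWeight c w b +_) (∑-single bump a off-a) ⟩
    classWeight c w b + bump a                              ≡⟨ cong (λ z → classWeight c w b + (if does (c a ≟ᵇ b) then z else 0ℤ))
                                                                 (trans (cong (_* v) (δ-≡ a)) (ℤₚ.*-identityˡ v)) ⟩
    classWeight c w b + (if does (c a ≟ᵇ b) then v else 0ℤ)       ∎
    where
    open ≡-Reasoning
    own bump : _ → ℤ
    own x = if does (c x ≟ᵇ b) then w x else 0ℤ
    bump x = if does (c x ≟ᵇ b) then δ a x * v else 0ℤ
    split : ∀ e p q → (if e then p + q else 0ℤ) ≡ (if e then p else 0ℤ) + (if e then q else 0ℤ)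
    split true p q = refl
    split false p q = refl
    off-a : ∀ x → x ≢ a → bump x ≡ 0ℤ
    off-a x x≢a with does (c x ≟ᵇ b)
    ... | false = refl
    ... | true = trans (cong (_* v) (δ-≢ x≢a)) (ℤₚ.*-zeroˡ v)

  bipartiteDet-cong : ∀ {k k′ m m′ W W′ V V′} → k ≡ k′ → m ≡ m′ → W ≡ W′ → V ≡ V′ →
    ∀ x y → bipartiteDet k m W V x y ≡ bipartiteDet k′ m′ W′ V′ x y
  bipartiteDet-cong refl refl refl refl x y = refl

  bipartiteDet-swap : ∀ k m W V x y → bipartiteDet k m W V x y ≡ bipartiteDet m k V W y x
  bipartiteDet-swap k m W V x y = swap (x ^ k) (y ^ m) W V (x ^ (k ∸ 1)) (y ^ (m ∸ 1))
    where
    swap : ∀ X Y W V X′ Y′ → X * Y - W * V * X′ * Y′ ≡ Y * X - V * W * Y′ * X′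
    swap = solve-∀

  twoClassDet-independent : ∀ {n} (c : Fin n → Bool) w d b b′ → twoClassDet c w d b ≡ twoClassDet c w d b′
  twoClassDet-independent c w d true true = refl
  twoClassDet-independent c w d false false = refl
  twoClassDet-independent c w d true false =
    bipartiteDet-swap (classSize c true) (classSize c false) (classWeight c w true) (classWeight c w false) (d true) (d false)
  twoClassDet-independent c w d false true =
    bipartiteDet-swap (classSize c false) (classSize c true) (classWeight c w false) (classWeight c w true) (d false) (d true)

  bipartiteDet-suc : ∀ k m W V x y → x * bipartiteDet (suc k) m W V x y ≡ bipartiteDet (suc (suc k)) m W V x y
  bipartiteDet-suc k m W V x y = distribute x (x ^ k) (y ^ m) W V (y ^ (m ∸ 1))
    where
    distribute : ∀ x X Y W V Y′ → x * (x * X * Y - W * V * X * Y′) ≡ x * (x * X) * Y - W * V * (x * X) * Y′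
    distribute = solve-∀

  twoClassDet-lone : ∀ {n} (c : Fin (suc n) → Bool) w d → (∀ i → c (fs i) ≡ not (c fz)) →
    twoClassDet c w d (c fz) ≡ bipartiteDet 1 n (w fz) (∑ (w ∘ fs)) (d (c fz)) (d (not (c fz)))
  twoClassDet-lone {n} c w d lone = bipartiteDet-cong size-b size-o weight-b weight-o (d b) (d o)
    where
    b = c fz
    o = not b
    o≢b : ∀ i → c (fs i) ≢ b
    o≢b i cᵢ≡b = not-¬ refl (trans (sym cᵢ≡b) (lone i))
    size-b : classSize c b ≡ 1
    size-b = cong₂ ℕ._+_ (if-same {b} refl) (classSize-empty (c ∘ fs) b o≢b)
    size-o : classSize c o ≡ n
    size-o = cong₂ ℕ._+_ (if-other (not-¬ {b} refl)) (classSize-full (c ∘ fs) o lone)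
    weight-b : classWeight c w b ≡ w fz
    weight-b = trans (cong₂ _+_ (if-same {b} refl) (classWeight-empty (c ∘ fs) (w ∘ fs) b o≢b)) (ℤₚ.+-identityʳ _)
    weight-o : classWeight c w o ≡ ∑ (w ∘ fs)
    weight-o = trans (cong₂ _+_ (if-other (not-¬ {b} refl)) (classWeight-full (c ∘ fs) (w ∘ fs) o lone))
                     (ℤₚ.+-identityˡ (∑ (w ∘ fs)))

  twoClassDet-uniform : ∀ {n} (c : Fin n → Bool) w d b → (∀ i → c i ≡ b) → twoClassDet c w d b ≡ d b ^ n
  twoClassDet-uniform {n} c w d b uniform =
    trans (bipartiteDet-cong {W = classWeight c w b} (classSize-full c b uniform) (classSize-empty c (not b) (not-¬ ∘ uniform)) refl
                             (classWeight-empty c w (not b) (not-¬ ∘ uniform)) (d b) (d (not b)))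
          (vanish (d b ^ n) (classWeight c w b) (d b ^ (n ∸ 1)))
    where
    vanish : ∀ X W X′ → X * 1ℤ - W * 0ℤ * X′ * 1ℤ ≡ X
    vanish = solve-∀

  weighted-power : ∀ {m} (f : Fin m → ℤ) y → y * ∑ f * y ^ (m ∸ 1) ≡ ∑ f * y ^ m
  weighted-power {zero} f y = cong (_* 1ℤ) (ℤₚ.*-zeroʳ y)
  weighted-power {suc m} f y = rearrange y (∑ f) (y ^ m)
    where
    rearrange : ∀ y S P → y * S * P ≡ S * (y * P)
    rearrange = solve-∀

  bipartiteDet-complete : ∀ k m t →
    bipartiteDet (suc k) (suc m) (ℤ.+ suc k) (ℤ.+ suc m) (t - ℤ.+ suc m) (t - ℤ.+ suc k)
      ≡ t * (t - ℤ.+ (suc m ℕ.+ suc k)) * (t - ℤ.+ suc m) ^ k * (t - ℤ.+ suc k) ^ m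
  bipartiteDet-complete k m t =
    trans (factor t (ℤ.+ suc m) (ℤ.+ suc k) ((t - ℤ.+ suc m) ^ k) ((t - ℤ.+ suc k) ^ m))
          (cong (λ z → t * (t - z) * (t - ℤ.+ suc m) ^ k * (t - ℤ.+ suc k) ^ m) (sym (ℤₚ.pos-+ (suc m) (suc k))))
    where
    factor : ∀ t P K A B → (t - P) * A * ((t - K) * B) - K * P * A * B ≡ t * (t - (P + K)) * A * B
    factor = solve-∀

  -- Vertex 0 has a partner fs a in its class. Column 0 minus column fs a is d b (e₀ − e_{fs a}); clearing row 0
  -- with this column and expanding leaves the two-class matrix of the other vertices, a having gained the weight w 0.
  module _ {n} (c : Fin (suc n) → Bool) (w : Fin (suc n) → ℤ) (d : Bool → ℤ) (a : Fin n) (partner : c (fs a) ≡ c fz) where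

    private
      b : Bool
      b = c fz
      M M₁ M₂ : Mat (suc n)
      M = twoClass c w d
      v : Fin (suc n) → ℤ
      v fz = 1ℤ
      v (fs x) = - δ a x
      M₁ = setCol M fz v
      clear : Fin (suc n) → ℤ
      clear j = if does (c j ≟ᵇ b) then 0ℤ else - w fz
      M₂ = addToColumns M₁ fz clear
      c′ : Fin n → Bool
      c′ = c ∘ fs
      w′ : Fin n → ℤ
      w′ x = w (fs x) + δ a x * w fz

    det-twoClass-partner-factor : det M ≡ d b * det M₁
    det-twoClass-partner-factor = begin
      det M                   ≡⟨ sym (det-add-column M {fz} {fs a} (λ ()) (- 1ℤ)) ⟩
      det (setCol M fz added) ≡⟨ det-scale-column fz (d b) (setCol M fz added) M₁
                                   (λ i j j≢0 → trans (setCol-≢ M fz added i j≢0) (sym (setCol-≢ M fz v i j≢0)))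
                                   (λ i → trans (setCol-≡ M fz added i) (trans (column i) (cong (d b *_) (sym (setCol-≡ M fz v i))))) ⟩
      d b * det M₁            ∎
      where
      open ≡-Reasoning
      added : Fin (suc n) → ℤ
      added i = M i fz + - 1ℤ * M i (fs a)
      column : ∀ i → added i ≡ d b * v i
      column fz = trans (cong₂ (λ p q → p + - 1ℤ * q) (twoClass-diag c w d fz) (twoClass-same c w d fz (fs a) (λ ()) (sym partner)))
                        (ring (d b))
        where
        ring : ∀ x → x + - 1ℤ * 0ℤ ≡ x * 1ℤ
        ring = solve-∀
      column (fs x) = by-cases (x ≟ᶠ a)
        where
        by-cases : Dec (x ≡ a) → added (fs x) ≡ d b * v (fs x)
        by-cases (yes refl) =
          trans (cong₂ (λ p q → p + - 1ℤ * q) (twoClass-same c w d (fs a) fz (λ ()) partner)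
                                               (trans (twoClass-diag c w d (fs a)) (cong d partner)))
                (trans (ring (d b)) (cong (λ z → d b * - z) (sym (δ-≡ a))))
          where
          ring : ∀ x → 0ℤ + - 1ℤ * x ≡ x * - 1ℤ
          ring = solve-∀
        by-cases (no x≢a) = trans (cong (λ z → M (fs x) fz + - 1ℤ * z) same-entry)
                                  (trans (ring (M (fs x) fz) (d b)) (cong (λ z → d b * - z) (sym (δ-≢ x≢a))))
          where
          same-entry : M (fs x) (fs a) ≡ M (fs x) fz
          same-entry = trans (twoClass-off c w d (fs x) (fs a) (x≢a ∘ suc-injective))
                        (trans (cong (λ z → if does (c (fs x) ≟ᵇ z) then 0ℤ else w (fs x)) partner)
                               (sym (twoClass-off c w d (fs x) fz λ ())))
          ring : ∀ X y → X + - 1ℤ * X ≡ y * - 0ℤ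
          ring = solve-∀

    partner-minor-entry : ∀ x y → twoClass c′ (w ∘ fs) d x y + clear (fs y) * - δ a x ≡ twoClass c′ w′ d x y
    partner-minor-entry x y = by-cases (x ≟ᶠ a)
      where
      by-cases : Dec (x ≡ a) → twoClass c′ (w ∘ fs) d x y + clear (fs y) * - δ a x ≡ twoClass c′ w′ d x y
      by-cases (no x≢a) = trans (cong (λ z → twoClass c′ (w ∘ fs) d x y + clear (fs y) * - z) (δ-≢ x≢a))
                                (trans (drop (twoClass c′ (w ∘ fs) d x y) (clear (fs y)))
                                       (twoClass-weight c′ (w ∘ fs) w′ d x y w′-unchanged))
        where
        drop : ∀ e k → e + k * - 0ℤ ≡ e
        drop = solve-∀
        ring : ∀ p q → p + 0ℤ * q ≡ p
        ring = solve-∀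
        w′-unchanged : w (fs x) ≡ w′ x
        w′-unchanged = sym (trans (cong (λ z → w (fs x) + z * w fz) (δ-≢ x≢a)) (ring (w (fs x)) (w fz)))
      by-cases (yes refl) = partner-row (x ≟ᶠ y) (c (fs y) ≟ᵇ b)
        where
        partner-row : Dec (x ≡ y) → Dec (c (fs y) ≡ b) →
          twoClass c′ (w ∘ fs) d x y + clear (fs y) * - δ x x ≡ twoClass c′ w′ d x y
        partner-row (yes refl) _ =
          trans (cong₂ (λ p q → p + q * - δ x x) (twoClass-diag c′ (w ∘ fs) d x) (if-same partner))
                (trans (ring (d (c′ x)) (δ x x)) (sym (twoClass-diag c′ w′ d x)))
          where
          ring : ∀ e k → e + 0ℤ * - k ≡ e
          ring = solve-∀
        partner-row (no x≢y) (yes same) =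
          trans (cong₂ (λ p q → p + q * - δ x x) (twoClass-same c′ (w ∘ fs) d x y x≢y (trans partner (sym same))) (if-same same))
                (sym (twoClass-same c′ w′ d x y x≢y (trans partner (sym same))))
        partner-row (no x≢y) (no other) =
          trans (cong₂ (λ p q → p + q * - δ x x) (twoClass-other c′ (w ∘ fs) d x y x≢y classes-differ) (if-other other))
                (trans (cong (λ z → w (fs x) + - w fz * - z) (δ-≡ x))
                       (trans (ring (w (fs x)) (w fz))
                              (sym (trans (twoClass-other c′ w′ d x y x≢y classes-differ) (cong (λ z → w (fs x) + z * w fz) (δ-≡ x))))))
          where
          classes-differ : c′ x ≢ c′ y
          classes-differ e = other (trans (sym e) partner)
          ring : ∀ p q → p + - q * - 1ℤ ≡ p + 1ℤ * q
          ring = solve-∀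

    det-twoClass-partner-minor : det M₁ ≡ det (twoClass c′ w′ d)
    det-twoClass-partner-minor = begin
      det M₁                             ≡⟨ sym (det-addToColumns M₁ fz clear (if-same {b} refl)) ⟩
      det M₂                             ≡⟨ det-row₀-single M₂ fz row₀ ⟩
      1ℤ * M₂ fz fz * det (minor M₂ fz)  ≡⟨ cong (λ z → 1ℤ * (1ℤ + z * 1ℤ) * det (minor M₂ fz)) (if-same {b} refl) ⟩
      1ℤ * 1ℤ * det (minor M₂ fz)        ≡⟨ ℤₚ.*-identityˡ _ ⟩
      det (minor M₂ fz)                  ≡⟨ det-cong (λ x y → trans (cong (_+ clear (fs y) * - δ a x) (twoClass-suc c w d x y))
                                                                       (partner-minor-entry x y)) ⟩
      det (twoClass c′ w′ d)             ∎
      where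
      open ≡-Reasoning
      row₀ : ∀ j → j ≢ fz → M₂ fz j ≡ 0ℤ
      row₀ fz 0≢0 = ⊥-elim (0≢0 refl)
      row₀ (fs y) _ = by-cases (c (fs y) ≟ᵇ b)
        where
        cancel : ∀ x → x + - x * 1ℤ ≡ 0ℤ
        cancel = solve-∀
        by-cases : Dec (c (fs y) ≡ b) → M₂ fz (fs y) ≡ 0ℤ
        by-cases (yes same) = cong₂ (λ p q → p + q * 1ℤ) (twoClass-same c w d fz (fs y) (λ ()) (sym same)) (if-same same)
        by-cases (no other) = trans (cong₂ (λ p q → p + q * 1ℤ) (twoClass-other c w d fz (fs y) (λ ()) (other ∘ sym)) (if-other other))
                                    (cancel (w fz))

    det-twoClass-partner : TwoClassFormula n →
      det M ≡ twoClassDet c w d b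
    det-twoClass-partner IH with classSize-nonempty c′ b partner
    ... | r , size≡ = begin
      det M                                               ≡⟨ det-twoClass-partner-factor ⟩
      d b * det M₁                                        ≡⟨ cong (d b *_) (trans det-twoClass-partner-minor (IH c′ w′ d b)) ⟩
      d b * twoClassDet c′ w′ d b
        ≡⟨ cong (d b *_) (bipartiteDet-cong {m = m} size≡ refl weight-b weight-o (d b) (d o)) ⟩
      d b * bipartiteDet (suc r) m (W + w fz) V (d b) (d o) ≡⟨ bipartiteDet-suc r m (W + w fz) V (d b) (d o) ⟩
      bipartiteDet (suc (suc r)) m (W + w fz) V (d b) (d o) ≡⟨ bipartiteDet-cong size-b size-o weight-b′ weight-o′ (d b) (d o) ⟩
      twoClassDet c w d b                                 ∎
      where
      open ≡-Reasoning
      o = not b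
      b≢o : b ≢ o
      b≢o = not-¬ refl
      m = classSize c′ o
      W = classWeight c′ (w ∘ fs) b
      V = classWeight c′ (w ∘ fs) o
      weight-b : classWeight c′ w′ b ≡ W + w fz
      weight-b = trans (classWeight-bump c′ (w ∘ fs) a (w fz) b) (cong (W +_) (if-same partner))
      weight-o : classWeight c′ w′ o ≡ V
      weight-o = trans (classWeight-bump c′ (w ∘ fs) a (w fz) o)
                       (trans (cong (V +_) (if-other (b≢o ∘ trans (sym partner)))) (ℤₚ.+-identityʳ V))
      size-b : suc (suc r) ≡ classSize c b
      size-b = trans (cong suc (sym size≡)) (cong (ℕ._+ classSize c′ b) (sym (if-same {b} refl)))
      size-o : m ≡ classSize c o
      size-o = cong (ℕ._+ m) (sym (if-other b≢o))
      weight-b′ : W + w fz ≡ classWeight c w b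
      weight-b′ = trans (ℤₚ.+-comm W (w fz)) (cong (_+ W) (sym (if-same {b} refl)))
      weight-o′ : V ≡ classWeight c w o
      weight-o′ = trans (sym (ℤₚ.+-identityˡ V)) (cong (_+ V) (sym (if-other b≢o)))

  replaceRow₀ : ∀ {n} → Mat (suc n) → (Fin (suc n) → ℤ) → Mat (suc n)
  replaceRow₀ M r fz = r
  replaceRow₀ M r (fs x) = M (fs x)

  unitRow₀ onesRow₀ : ∀ {n} → Fin (suc n) → ℤ
  unitRow₀ fz = 1ℤ
  unitRow₀ (fs _) = 0ℤ
  onesRow₀ fz = 0ℤ
  onesRow₀ (fs _) = 1ℤ

  -- Vertex 0 is alone in its class, so row 0 is d b e₀ + w 0 (0, 1, …, 1). The first part leaves the diagonal
  -- minor of the other class. In the second, subtracting column 1 from the later columns and expanding along row 0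
  -- gives a two-class matrix in which vertex 1 is alone, with diagonal entry w 1 and weight − d o.
  module _ {n} (c : Fin (suc (suc n)) → Bool) (w : Fin (suc (suc n)) → ℤ) (d : Bool → ℤ)
           (lone : ∀ i → c (fs i) ≡ not (c fz)) where

    private
      b o : Bool
      b = c fz
      o = not b
      M R R′ : Mat (suc (suc n))
      M = twoClass c w d
      R = replaceRow₀ M onesRow₀
      shift : Fin (suc (suc n)) → ℤ
      shift (fs (fs _)) = - 1ℤ
      shift _ = 0ℤ
      R′ = addToColumns R (fs fz) shift
      c′ : Fin (suc n) → Bool
      c′ fz = b
      c′ (fs _) = o
      w′ : Fin (suc n) → ℤ
      w′ fz = - d o
      w′ (fs y) = w (fs (fs y))
      d′ : Bool → ℤ
      d′ z = if does (z ≟ᵇ b) then w (fs fz) else d z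

      o≢b : o ≢ b
      o≢b o≡b = not-¬ refl (sym o≡b)
      inner-same : ∀ {x y} → x ≢ y → M (fs (fs x)) (fs (fs y)) ≡ 0ℤ
      inner-same {x} {y} x≢y =
        twoClass-same c w d (fs (fs x)) (fs (fs y)) (x≢y ∘ suc-injective ∘ suc-injective) (trans (lone _) (sym (lone _)))
      column-1 : ∀ x → M (fs (fs x)) (fs fz) ≡ 0ℤ
      column-1 x = twoClass-same c w d (fs (fs x)) (fs fz) (λ ()) (trans (lone _) (sym (lone _)))
      column-0 : ∀ x → M (fs x) fz ≡ w (fs x)
      column-0 x = twoClass-other c w d (fs x) fz (λ ()) (o≢b ∘ trans (sym (lone x)))

    det-twoClass-split-row₀ : det M ≡ d b * det (twoClass (c ∘ fs) (w ∘ fs) d) + w fz * det (replaceRow₀ M onesRow₀)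
    det-twoClass-split-row₀ =
      trans (det-linear-row₀ (d b) (w fz) M (replaceRow₀ M unitRow₀) (replaceRow₀ M onesRow₀) (λ _ _ → refl) (λ _ _ → refl) row₀)
            (cong (λ z → d b * z + w fz * det (replaceRow₀ M onesRow₀)) unit-expansion)
      where
      row₀ : ∀ j → M fz j ≡ d b * unitRow₀ j + w fz * onesRow₀ j
      row₀ fz = trans (twoClass-diag c w d fz) (pad (d b) (w fz))
        where
        pad : ∀ x y → x ≡ x * 1ℤ + y * 0ℤ
        pad = solve-∀
      row₀ (fs j) = trans (twoClass-other c w d fz (fs j) (λ ()) (λ b≡cⱼ → o≢b (trans (sym (lone j)) (sym b≡cⱼ))))
                          (pad (d b) (w fz))
        where
        pad : ∀ x y → y ≡ x * 0ℤ + y * 1ℤ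
        pad = solve-∀
      unit-expansion : det (replaceRow₀ M unitRow₀) ≡ det (twoClass (c ∘ fs) (w ∘ fs) d)
      unit-expansion =
        trans (det-row₀-single (replaceRow₀ M unitRow₀) fz λ { fz 0≢0 → ⊥-elim (0≢0 refl) ; (fs j) _ → refl })
              (trans (ℤₚ.*-identityˡ _) (det-cong (twoClass-suc c w d)))

    minor-replaceRow₀-ones : ∀ x y → minor R′ (fs fz) x y ≡ twoClass c′ w′ d′ x y
    minor-replaceRow₀-ones fz fz = begin
      M (fs fz) fz + 0ℤ * M (fs fz) (fs fz) ≡⟨ cong₂ _+_ (column-0 fz) (ℤₚ.*-zeroˡ (M (fs fz) (fs fz))) ⟩
      w (fs fz) + 0ℤ                        ≡⟨ ℤₚ.+-identityʳ _ ⟩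
      w (fs fz)                             ≡⟨ sym (if-same {b} refl) ⟩
      d′ b                                  ≡⟨ sym (twoClass-diag c′ w′ d′ fz) ⟩
      twoClass c′ w′ d′ fz fz               ∎
      where open ≡-Reasoning
    minor-replaceRow₀-ones fz (fs y) = begin
      M (fs fz) (fs (fs y)) + - 1ℤ * M (fs fz) (fs fz)
        ≡⟨ cong₂ (λ u v → u + - 1ℤ * v) (twoClass-same c w d (fs fz) (fs (fs y)) (λ ()) (trans (lone fz) (sym (lone (fs y)))))
                                         (trans (twoClass-diag c w d (fs fz)) (cong d (lone fz))) ⟩
      0ℤ + - 1ℤ * d o    ≡⟨ negate (d o) ⟩
      - d o              ≡⟨ sym (twoClass-other c′ w′ d′ fz (fs y) (λ ()) (o≢b ∘ sym)) ⟩
      twoClass c′ w′ d′ fz (fs y) ∎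
      where
      open ≡-Reasoning
      negate : ∀ x → 0ℤ + - 1ℤ * x ≡ - x
      negate = solve-∀
    minor-replaceRow₀-ones (fs x) fz =
      trans (cong₂ _+_ (column-0 (fs x)) (ℤₚ.*-zeroˡ (M (fs (fs x)) (fs fz))))
            (trans (ℤₚ.+-identityʳ _) (sym (twoClass-other c′ w′ d′ (fs x) fz (λ ()) o≢b)))
    minor-replaceRow₀-ones (fs x) (fs y) =
      trans (cong (λ z → M (fs (fs x)) (fs (fs y)) + - 1ℤ * z) (column-1 x))
            (trans (ℤₚ.+-identityʳ _) (by-cases (x ≟ᶠ y)))
      where
      by-cases : Dec (x ≡ y) → M (fs (fs x)) (fs (fs y)) ≡ twoClass c′ w′ d′ (fs x) (fs y)
      by-cases (yes refl) = trans (twoClass-diag c w d _) (trans (cong d (lone (fs x)))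
                              (sym (trans (twoClass-diag c′ w′ d′ (fs x)) (if-other o≢b))))
      by-cases (no x≢y) = trans (inner-same x≢y) (sym (twoClass-same c′ w′ d′ (fs x) (fs y) (x≢y ∘ suc-injective) refl))

    det-replaceRow₀-ones : TwoClassFormula (suc n) →
      det R ≡ - (∑ (w ∘ fs) * d o ^ n)
    det-replaceRow₀-ones IH = begin
      det R                                 ≡⟨ sym (det-addToColumns R (fs fz) shift refl) ⟩
      det R′                                ≡⟨ det-row₀-single R′ (fs fz) row₀ ⟩
      - 1ℤ * 1ℤ * det (minor R′ (fs fz))    ≡⟨ cong (- 1ℤ * 1ℤ *_) (det-cong minor-replaceRow₀-ones) ⟩
      - 1ℤ * 1ℤ * det (twoClass c′ w′ d′)   ≡⟨ cong (- 1ℤ * 1ℤ *_) minor-det ⟩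
      - 1ℤ * 1ℤ * bipartiteDet 1 n (- d o) S (w (fs fz)) (d o)
        ≡⟨ expand (w (fs fz)) S (d o) (d o ^ n) (d o ^ (n ∸ 1)) ⟩
      - (w (fs fz) * d o ^ n + d o * S * d o ^ (n ∸ 1))
        ≡⟨ cong (λ z → - (w (fs fz) * d o ^ n + z)) (weighted-power (w ∘ fs ∘ fs) (d o)) ⟩
      - (w (fs fz) * d o ^ n + S * d o ^ n) ≡⟨ cong -_ (sym (ℤₚ.*-distribʳ-+ (d o ^ n) (w (fs fz)) S)) ⟩
      - (∑ (w ∘ fs) * d o ^ n)              ∎
      where
      open ≡-Reasoning
      S = ∑ (w ∘ fs ∘ fs)
      minor-det : det (twoClass c′ w′ d′) ≡ bipartiteDet 1 n (- d o) S (w (fs fz)) (d o)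
      minor-det = trans (IH c′ w′ d′ b) (trans (twoClassDet-lone c′ w′ d′ λ _ → refl)
                    (cong₂ (bipartiteDet 1 n (- d o) S) (if-same {b} refl) (if-other o≢b)))
      row₀ : ∀ j → j ≢ fs fz → R′ fz j ≡ 0ℤ
      row₀ fz _ = refl
      row₀ (fs fz) 1≢1 = ⊥-elim (1≢1 refl)
      row₀ (fs (fs _)) _ = refl
      expand : ∀ w₁ S y Y Y′ → - 1ℤ * 1ℤ * (w₁ * 1ℤ * Y - - y * S * 1ℤ * Y′) ≡ - (w₁ * Y + y * S * Y′)
      expand = solve-∀

    det-twoClass-lone : TwoClassFormula (suc n) →
      det M ≡ twoClassDet c w d b
    det-twoClass-lone IH = begin
      det M                                                              ≡⟨ det-twoClass-split-row₀ ⟩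
      d b * det (twoClass (c ∘ fs) (w ∘ fs) d) + w fz * det R
        ≡⟨ cong₂ (λ u v → d b * u + w fz * v) rest-diagonal (det-replaceRow₀-ones IH) ⟩
      d b * d o ^ suc n + w fz * - (∑ (w ∘ fs) * d o ^ n)                ≡⟨ rearrange (d b) (d o) (w fz) (∑ (w ∘ fs)) (d o ^ n) ⟩
      bipartiteDet 1 (suc n) (w fz) (∑ (w ∘ fs)) (d b) (d o)              ≡⟨ sym (twoClassDet-lone c w d lone) ⟩
      twoClassDet c w d b                                                ∎
      where
      open ≡-Reasoning
      rest-diagonal : det (twoClass (c ∘ fs) (w ∘ fs) d) ≡ d o ^ suc n
      rest-diagonal = trans (IH (c ∘ fs) (w ∘ fs) d o) (twoClassDet-uniform (c ∘ fs) (w ∘ fs) d o lone)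
      rearrange : ∀ x y w₀ V Y → x * (y * Y) + w₀ * - (V * Y) ≡ x * 1ℤ * (y * Y) - w₀ * V * 1ℤ * Y
      rearrange = solve-∀

  det-twoClass-step : ∀ {n} → TwoClassFormula (suc n) →
    ∀ (c : Fin (suc (suc n)) → Bool) w d → Dec (∃ λ a → c (fs a) ≡ c fz) → det (twoClass c w d) ≡ twoClassDet c w d (c fz)
  det-twoClass-step IH c w d (yes (a , partner)) = det-twoClass-partner c w d a partner IH
  det-twoClass-step IH c w d (no no-partner) = det-twoClass-lone c w d (λ i → ¬-not λ e → no-partner (i , e)) IH

  det-twoClass : ∀ {n} → TwoClassFormula n
  det-twoClass {zero} c w d b = refl
  det-twoClass {suc zero} c w d b =
    trans (trans (single (d (c fz)) (w fz) (d (not (c fz)))) (sym (twoClassDet-lone c w d λ ())))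
          (twoClassDet-independent c w d (c fz) b)
    where
    single : ∀ x w₀ y → 1ℤ * x * 1ℤ + 0ℤ ≡ x * 1ℤ * 1ℤ - w₀ * 0ℤ * 1ℤ * 1ℤ
    single = solve-∀
  det-twoClass {suc (suc n)} c w d b =
    trans (det-twoClass-step (det-twoClass {suc n}) c w d (any? λ a → c (fs a) ≟ᵇ c fz))
          (twoClassDet-independent c w d (c fz) b)

module CompleteBipartiteSpectrum where
  open import Data.Nat as ℕ using (ℕ; zero; suc; _+_; _∸_; _<_; s≤s)
  import Data.Nat.Properties as ℕₚ
  open import Data.Integer using (ℤ; _*_; _-_; _^_)
  import Data.Integer as ℤ using (+_)
  import Data.Integer.Properties as ℤₚ
  open import Data.Integer.Tactic.RingSolver using (solve-∀)
  open import Data.List using (List; []; _∷_; _++_; map; replicate; length)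
  import Data.List.Properties as Listₚ
  open import Relation.Binary.PropositionalEquality
  open TwoClass using (bipartiteDet; bipartiteDet-complete)

  spectrumPolynomial : ℕ → ℕ → ℤ → ℤ
  spectrumPolynomial p q t = t * (t - ℤ.+ (p + q ∸ 2)) * ((t - ℤ.+ (p ∸ 1)) ^ (q ∸ 2)) * ((t - ℤ.+ (q ∸ 1)) ^ (p ∸ 2))

  eigenvalues : ℕ → ℕ → List ℤ
  eigenvalues p q = ℤ.+ 0 ∷ ℤ.+ (p + q ∸ 2) ∷ replicate (q ∸ 2) (ℤ.+ (p ∸ 1)) ++ replicate (p ∸ 2) (ℤ.+ (q ∸ 1))

  ∏-++ : ∀ xs ys → ∏ (xs ++ ys) ≡ ∏ xs * ∏ ys
  ∏-++ [] ys = sym (ℤₚ.*-identityˡ (∏ ys))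
  ∏-++ (x ∷ xs) ys = trans (cong (x *_) (∏-++ xs ys)) (sym (ℤₚ.*-assoc x (∏ xs) (∏ ys)))

  ∏-replicate : ∀ k x → ∏ (replicate k x) ≡ x ^ k
  ∏-replicate zero x = refl
  ∏-replicate (suc k) x = cong (x *_) (∏-replicate k x)

  ∏-eigenvalues : ∀ p q t → ∏ (map (t -_) (eigenvalues p q)) ≡ spectrumPolynomial p q t
  ∏-eigenvalues p q t = begin
    (t - ℤ.+ 0) * ((t - ℤ.+ (p + q ∸ 2)) * ∏ (map (t -_) (xs ++ ys)))
      ≡⟨ cong (λ z → (t - ℤ.+ 0) * ((t - ℤ.+ (p + q ∸ 2)) * z))
              (trans (cong ∏ (Listₚ.map-++ (t -_) xs ys)) (∏-++ (map (t -_) xs) (map (t -_) ys))) ⟩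
    (t - ℤ.+ 0) * ((t - ℤ.+ (p + q ∸ 2)) * (∏ (map (t -_) xs) * ∏ (map (t -_) ys)))
      ≡⟨ cong₂ (λ u v → (t - ℤ.+ 0) * ((t - ℤ.+ (p + q ∸ 2)) * (u * v))) (power (q ∸ 2) (p ∸ 1)) (power (p ∸ 2) (q ∸ 1)) ⟩
    (t - ℤ.+ 0) * ((t - ℤ.+ (p + q ∸ 2)) * ((t - ℤ.+ (p ∸ 1)) ^ (q ∸ 2) * (t - ℤ.+ (q ∸ 1)) ^ (p ∸ 2)))
      ≡⟨ reassociate t (ℤ.+ (p + q ∸ 2)) ((t - ℤ.+ (p ∸ 1)) ^ (q ∸ 2)) ((t - ℤ.+ (q ∸ 1)) ^ (p ∸ 2)) ⟩
    spectrumPolynomial p q t ∎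
    where
    open ≡-Reasoning
    xs = replicate (q ∸ 2) (ℤ.+ (p ∸ 1))
    ys = replicate (p ∸ 2) (ℤ.+ (q ∸ 1))
    power : ∀ k e → ∏ (map (t -_) (replicate k (ℤ.+ e))) ≡ (t - ℤ.+ e) ^ k
    power k e = trans (cong ∏ (Listₚ.map-replicate (t -_) k (ℤ.+ e))) (∏-replicate k (t - ℤ.+ e))
    reassociate : ∀ t b A B → (t - ℤ.+ 0) * ((t - b) * (A * B)) ≡ t * (t - b) * A * B
    reassociate = solve-∀

  bipartiteDet-spectrum : ∀ {p q k m} → 1 < p → 1 < q → suc k ≡ q → suc m ≡ p → ∀ t →
    bipartiteDet k m (ℤ.+ k) (ℤ.+ m) (t - ℤ.+ m) (t - ℤ.+ k) ≡ spectrumPolynomial p q t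
  bipartiteDet-spectrum {k = zero} _ (s≤s ()) refl _ t
  bipartiteDet-spectrum {k = suc k} {zero} (s≤s ()) _ _ refl t
  bipartiteDet-spectrum {k = suc k} {suc m} _ _ refl refl t =
    trans (bipartiteDet-complete k m t)
          (cong (λ z → t * (t - ℤ.+ z) * (t - ℤ.+ suc m) ^ k * (t - ℤ.+ suc k) ^ m) (sym (ℕₚ.+-suc m (suc k))))

  length-eigenvalues : ∀ {p q k m} → 1 < p → 1 < q → suc k ≡ q → suc m ≡ p → length (eigenvalues p q) ≡ k + m
  length-eigenvalues {k = zero} _ (s≤s ()) refl _
  length-eigenvalues {k = suc k} {zero} (s≤s ()) _ _ refl
  length-eigenvalues {k = suc k} {suc m} _ _ refl refl = begin
    suc (suc (length (replicate k (ℤ.+ suc m) ++ replicate m (ℤ.+ suc k))))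
      ≡⟨ cong (λ z → suc (suc z)) (trans (Listₚ.length-++ (replicate k _))
                                         (cong₂ _+_ (Listₚ.length-replicate k) (Listₚ.length-replicate m))) ⟩
    suc (suc (k + m)) ≡⟨ cong suc (sym (ℕₚ.+-suc k m)) ⟩
    suc k + suc m     ∎
    where open ≡-Reasoning

module ModularArithmetic where
  open import Data.Nat
  open import Data.Nat.Properties
  open import Data.Nat.DivMod
  open import Data.Nat.Coprimality using (Coprime; coprime-Bézout)
  open import Data.Nat.GCD using (module Bézout)
  open import Data.Nat.Tactic.RingSolver using (solve-∀)
  open import Data.Product using (∃; _,_)
  open import Relation.Binary.PropositionalEquality

  modular-inverse : ∀ a n .{{_ : NonZero n}} → 1 < n → Coprime a n → ∃ λ u → (a * u) % n ≡ 1
  modular-inverse a n@(suc n-1) 1<n coprime with coprime-Bézout coprime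
  ... | Bézout.+- x y 1+yn≡xa = x , (begin
    (a * x) % n         ≡⟨ cong (_% n) (trans (*-comm a x) (sym 1+yn≡xa)) ⟩
    (1 + y * n) % n     ≡⟨ [m+kn]%n≡m%n 1 y n ⟩
    1 % n               ≡⟨ m<n⇒m%n≡m 1<n ⟩
    1                   ∎)
    where open ≡-Reasoning
  -- Here x a ≡ −1 modulo n, so x (n − 1) inverts a.
  ... | Bézout.-+ x y 1+xa≡yn = x * n-1 , (begin
    (a * (x * n-1)) % n             ≡⟨ sym ([m+kn]%n≡m%n (a * (x * n-1)) 1 n) ⟩
    (a * (x * n-1) + 1 * n) % n     ≡⟨ cong (_% n) rearranged ⟩
    (1 + (y * n-1) * n) % n         ≡⟨ [m+kn]%n≡m%n 1 (y * n-1) n ⟩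
    1 % n                           ≡⟨ m<n⇒m%n≡m 1<n ⟩
    1                               ∎)
    where
    open ≡-Reasoning
    expand : ∀ a x k → a * (x * k) + 1 * suc k ≡ suc ((1 + x * a) * k)
    expand = solve-∀
    collect : ∀ y k → suc (y * suc k * k) ≡ 1 + (y * k) * suc k
    collect = solve-∀
    rearranged : a * (x * n-1) + 1 * n ≡ 1 + (y * n-1) * n
    rearranged = trans (expand a x n-1) (trans (cong (λ z → suc (z * n-1)) 1+xa≡yn) (collect y n-1))

  %-absorbʳ : ∀ a u n .{{_ : NonZero n}} → (a * (u % n)) % n ≡ (a * u) % n
  %-absorbʳ a u n = begin
    (a * (u % n)) % n            ≡⟨ %-distribˡ-* a (u % n) n ⟩
    ((a % n) * (u % n % n)) % n  ≡⟨ cong (λ z → ((a % n) * z) % n) (m%n%n≡m%n u n) ⟩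
    ((a % n) * (u % n)) % n      ≡⟨ sym (%-distribˡ-* a u n) ⟩
    (a * u) % n                  ∎
    where open ≡-Reasoning

  %-absorbˡ : ∀ u a n .{{_ : NonZero n}} → ((u % n) * a) % n ≡ (u * a) % n
  %-absorbˡ u a n = trans (cong (_% n) (*-comm (u % n) a)) (trans (%-absorbʳ a u n) (cong (_% n) (*-comm a u)))

module PrimeDivisors where
  open import Data.Nat
  open import Data.Nat.Divisibility using (_∣_; ∣-trans)
  open import Data.Nat.Coprimality using (Coprime; coprime-divisor)
  open import Data.Nat.Primality using (Prime; prime⇒irreducible; prime⇒nonTrivial)
  open import Data.Nat.Properties using (<-irrefl)
  open import Data.Sum using (inj₁; inj₂)
  open import Data.Product using (_,_)
  open import Data.Empty using (⊥-elim)
  open import Relation.Nullary using (¬_)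
  open import Relation.Binary.PropositionalEquality

  prime⇒coprime-nondivisor : ∀ {p k} → Prime p → ¬ p ∣ k → Coprime k p
  prime⇒coprime-nondivisor p-prime p∤k (d∣k , d∣p) with prime⇒irreducible p-prime d∣p
  ... | inj₁ d≡1 = d≡1
  ... | inj₂ refl = ⊥-elim (p∤k d∣k)

  1<prime : ∀ {r} → Prime r → 1 < r
  1<prime {r} r-prime = nonTrivial⇒n>1 r {{prime⇒nonTrivial r-prime}}

  prime∤prime : ∀ {a b} → Prime a → Prime b → a ≢ b → ¬ a ∣ b
  prime∤prime a-prime b-prime a≢b a∣b with prime⇒irreducible b-prime a∣b
  ... | inj₁ a≡1 = <-irrefl (sym a≡1) (1<prime a-prime)
  ... | inj₂ a≡b = a≢b a≡b

  coprime-* : ∀ {a m n} → Coprime a m → Coprime a n → Coprime a (m * n)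
  coprime-* {a} {m} {n} a⊥m a⊥n {d} (d∣a , d∣mn) = a⊥n (d∣a , coprime-divisor d⊥m d∣mn)
    where
    d⊥m : Coprime d m
    d⊥m (e∣d , e∣m) = a⊥m (∣-trans e∣d d∣a , e∣m)

module SemiprimeResidues (p q : ℕ) (p-prime : Prime p) (q-prime : Prime q) (p≢q : p ≢ q) where
  open import Data.Nat
  open import Data.Nat.Properties
  open import Data.Nat.Divisibility
  open import Data.Nat.DivMod
  open import Data.Nat.Primality using (prime⇒nonZero; euclidsLemma)
  open import Data.Nat.Tactic.RingSolver using (solve-∀)
  open import Data.Fin using (Fin; toℕ; fromℕ<)
  open import Data.Fin.Properties using (toℕ<n; toℕ-fromℕ<)
  open import Data.Bool using (Bool; true; false; not; _∧_)
  open import Data.Bool.Properties using (not-¬) renaming (_≟_ to _≟ᵇ_)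
  open import Data.Product using (_×_; _,_; proj₁; proj₂)
  open import Data.Sum using (_⊎_; inj₁; inj₂)
  open import Data.Empty using (⊥; ⊥-elim)
  open import Relation.Nullary using (¬_; yes; no; does; ¬?; _×-dec_)
  open import Relation.Nullary.Decidable using (dec-true; dec-false; does-⇔)
  open import Function.Bundles using (_⇔_; mk⇔)
  open import Relation.Binary.PropositionalEquality
  open import Function using (_∘_; id)
  open ModularArithmetic
  open PrimeDivisors
  open Counting
  open TwoClass using (classSize)

  instance
    pq≢0 : NonZero (p * q)
    pq≢0 = nonZeroPQ p-prime q-prime
    p≢0 : NonZero p
    p≢0 = prime⇒nonZero p-prime
    q≢0 : NonZero q
    q≢0 = prime⇒nonZero q-prime

  open ZMod (p * q) public

  1<pq : 1 < p * q
  1<pq = <-≤-trans (1<prime p-prime) (m≤m*n p q)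

  1%pq≡1 : 1 % (p * q) ≡ 1
  1%pq≡1 = m<n⇒m%n≡m 1<pq

  multiple⇒¬unit : ∀ d .{{_ : NonZero d}} → 1 < d → d ∣ p * q → (x : Fin (p * q)) → d ∣ toℕ x → ¬ IsUnit x
  multiple⇒¬unit d 1<d d∣pq x d∣x (y , xy≡1) = <-irrefl (sym (∣1⇒≡1 d∣1)) 1<d
    where
    d∣1 : d ∣ 1
    d∣1 = subst (d ∣_) (trans xy≡1 1%pq≡1) (%-presˡ-∣ (∣-trans d∣x (m∣m*n (toℕ y))) d∣pq)

  coprime⇒unit : (x : Fin (p * q)) → ¬ p ∣ toℕ x → ¬ q ∣ toℕ x → IsUnit x
  coprime⇒unit x p∤x q∤x = fromℕ< (m%n<n u (p * q)) , (begin
    (toℕ x * toℕ (fromℕ< (m%n<n u (p * q)))) % (p * q) ≡⟨ cong (λ z → (toℕ x * z) % (p * q)) (toℕ-fromℕ< (m%n<n u (p * q))) ⟩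
    (toℕ x * (u % (p * q))) % (p * q)                  ≡⟨ %-absorbʳ (toℕ x) u (p * q) ⟩
    (toℕ x * u) % (p * q)                              ≡⟨ xu≡1 ⟩
    1                                                  ≡⟨ sym 1%pq≡1 ⟩
    1 % (p * q)                                        ∎)
    where
    open ≡-Reasoning
    inverse = modular-inverse (toℕ x) (p * q) 1<pq
                (coprime-* (prime⇒coprime-nondivisor p-prime p∤x) (prime⇒coprime-nondivisor q-prime q∤x))
    u = proj₁ inverse
    xu≡1 = proj₂ inverse

  ¬both : (x : Fin (p * q)) → toℕ x ≢ 0 → p ∣ toℕ x → q ∣ toℕ x → ⊥
  ¬both x x≢0 (divides k x≡kp) q∣x with euclidsLemma k p q-prime (subst (q ∣_) x≡kp q∣x)
  ... | inj₂ q∣p = prime∤prime q-prime p-prime (p≢q ∘ sym) q∣p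
  ... | inj₁ (divides j k≡jq) = <⇒≱ (toℕ<n x) (∣⇒≤ {{≢-nonZero x≢0}} pq∣x)
    where
    reassociate : ∀ j q p → j * q * p ≡ j * (p * q)
    reassociate = solve-∀
    pq∣x : p * q ∣ toℕ x
    pq∣x = divides j (trans x≡kp (trans (cong (_* p) k≡jq) (reassociate j q p)))

  divisibleByP : Fin (p * q) → Bool
  divisibleByP x = does (p ∣? toℕ x)

  vertex-factor : ∀ x → IsVertex x → (p ∣ toℕ x × ¬ q ∣ toℕ x) ⊎ (q ∣ toℕ x × ¬ p ∣ toℕ x)
  vertex-factor x (x≢0 , ¬unit) with p ∣? toℕ x | q ∣? toℕ x
  ... | yes p∣x | yes q∣x = ⊥-elim (¬both x x≢0 p∣x q∣x)
  ... | yes p∣x | no q∤x = inj₁ (p∣x , q∤x)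
  ... | no p∤x | yes q∣x = inj₂ (q∣x , p∤x)
  ... | no p∤x | no q∤x = ⊥-elim (¬unit (coprime⇒unit x p∤x q∤x))

  -- With y = k a and b ∤ k, an inverse u of k modulo b gives the witness j u for x = j a.
  inIdeal-sameFactor : ∀ a b → Prime b → a * b ≡ p * q → ∀ x y → a ∣ toℕ x → a ∣ toℕ y → ¬ b ∣ toℕ y → InIdeal x y
  inIdeal-sameFactor a b b-prime ab≡pq x y (divides j x≡ja) (divides k y≡ka) b∤y = fromℕ< (m%n<n r (p * q)) , (begin
    (toℕ (fromℕ< (m%n<n r (p * q))) * toℕ y) % (p * q) ≡⟨ cong (λ z → (z * toℕ y) % (p * q)) (toℕ-fromℕ< (m%n<n r (p * q))) ⟩
    ((r % (p * q)) * toℕ y) % (p * q)                  ≡⟨ %-absorbˡ r (toℕ y) (p * q) ⟩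
    (r * toℕ y) % (p * q)                              ≡⟨ cong (_% (p * q)) ry≡x+jspq ⟩
    (toℕ x + j * s * (p * q)) % (p * q)                ≡⟨ [m+kn]%n≡m%n (toℕ x) (j * s) (p * q) ⟩
    toℕ x % (p * q)                                    ≡⟨ m<n⇒m%n≡m (toℕ<n x) ⟩
    toℕ x                                              ∎)
    where
    open ≡-Reasoning
    instance
      b≢0 : NonZero b
      b≢0 = prime⇒nonZero b-prime
    b∤k : ¬ b ∣ k
    b∤k b∣k = b∤y (subst (b ∣_) (sym y≡ka) (∣-trans b∣k (m∣m*n a)))
    inverse = modular-inverse k b (1<prime b-prime) (prime⇒coprime-nondivisor b-prime b∤k)
    u = proj₁ inverse
    s = (k * u) / b
    ku≡1+sb : k * u ≡ 1 + s * b
    ku≡1+sb = trans (m≡m%n+[m/n]*n (k * u) b) (cong (_+ s * b) (proj₂ inverse))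
    r = j * u
    regroup : ∀ j u k a → j * u * (k * a) ≡ j * a * (k * u)
    regroup = solve-∀
    expand : ∀ j a s b → j * a * (1 + s * b) ≡ j * a + j * s * (a * b)
    expand = solve-∀
    ry≡x+jspq : r * toℕ y ≡ toℕ x + j * s * (p * q)
    ry≡x+jspq = begin
      r * toℕ y               ≡⟨ cong (r *_) y≡ka ⟩
      j * u * (k * a)         ≡⟨ regroup j u k a ⟩
      j * a * (k * u)         ≡⟨ cong (j * a *_) ku≡1+sb ⟩
      j * a * (1 + s * b)     ≡⟨ expand j a s b ⟩
      j * a + j * s * (a * b) ≡⟨ cong₂ (λ z w → z + j * s * w) (sym x≡ja) ab≡pq ⟩
      toℕ x + j * s * (p * q) ∎

  ¬inIdeal : ∀ d .{{_ : NonZero d}} → d ∣ p * q → ∀ x y → d ∣ toℕ y → ¬ d ∣ toℕ x → ¬ InIdeal x y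
  ¬inIdeal d d∣pq x y d∣y d∤x (r , ry≡x) = d∤x (subst (d ∣_) ry≡x (%-presˡ-∣ (∣-trans d∣y (n∣m*n (toℕ r))) d∣pq))

  adj?-vertices : ∀ x y → IsVertex x → IsVertex y → does (adj? x y) ≡ not (does (divisibleByP x ≟ᵇ divisibleByP y))
  adj?-vertices x y x-vertex y-vertex with vertex-factor x x-vertex | vertex-factor y y-vertex
  ... | inj₁ (p∣x , q∤x) | inj₁ (p∣y , q∤y) =
    trans (dec-false (adj? x y) λ (_ , x∉Ry , _) → x∉Ry (inIdeal-sameFactor p q q-prime refl x y p∣x p∣y q∤y))
          (cong₂ (λ u v → not (does (u ≟ᵇ v))) (sym (dec-true (p ∣? toℕ x) p∣x)) (sym (dec-true (p ∣? toℕ y) p∣y)))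
  ... | inj₂ (q∣x , p∤x) | inj₂ (q∣y , p∤y) =
    trans (dec-false (adj? x y) λ (_ , x∉Ry , _) → x∉Ry (inIdeal-sameFactor q p p-prime (*-comm q p) x y q∣x q∣y p∤y))
          (cong₂ (λ u v → not (does (u ≟ᵇ v))) (sym (dec-false (p ∣? toℕ x) p∤x)) (sym (dec-false (p ∣? toℕ y) p∤y)))
  ... | inj₁ (p∣x , q∤x) | inj₂ (q∣y , p∤y) =
    trans (dec-true (adj? x y) ((λ { refl → p∤y p∣x }) , ¬inIdeal q (n∣m*n p) x y q∣y q∤x , ¬inIdeal p (m∣m*n q) y x p∣x p∤y))
          (cong₂ (λ u v → not (does (u ≟ᵇ v))) (sym (dec-true (p ∣? toℕ x) p∣x)) (sym (dec-false (p ∣? toℕ y) p∤y)))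
  ... | inj₂ (q∣x , p∤x) | inj₁ (p∣y , q∤y) =
    trans (dec-true (adj? x y) ((λ { refl → p∤x p∣y }) , ¬inIdeal p (m∣m*n q) x y p∣y p∤x , ¬inIdeal q (n∣m*n p) y x q∣x q∤y))
          (cong₂ (λ u v → not (does (u ≟ᵇ v))) (sym (dec-false (p ∣? toℕ x) p∤x)) (sym (dec-true (p ∣? toℕ y) p∣y)))

  nonzero-multiple : ℕ → ℕ → Bool
  nonzero-multiple d i = not (does (i ≟ 0)) ∧ does (d ∣? i)

  vertex∧p⇔ : ∀ x → (IsVertex x × divisibleByP x ≡ true) ⇔ (toℕ x ≢ 0 × p ∣ toℕ x)
  vertex∧p⇔ x = mk⇔ to (λ (x≢0 , p∣x) → (x≢0 , multiple⇒¬unit p (1<prime p-prime) (m∣m*n q) x p∣x)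
                                        , dec-true (p ∣? toℕ x) p∣x)
    where
    to : IsVertex x × divisibleByP x ≡ true → toℕ x ≢ 0 × p ∣ toℕ x
    to ((x≢0 , _) , in-p) with p ∣? toℕ x | in-p
    ... | yes p∣x | _ = x≢0 , p∣x
    ... | no _ | ()

  vertex∧q⇔ : ∀ x → (IsVertex x × divisibleByP x ≡ false) ⇔ (toℕ x ≢ 0 × q ∣ toℕ x)
  vertex∧q⇔ x = mk⇔ to (λ (x≢0 , q∣x) → (x≢0 , multiple⇒¬unit q (1<prime q-prime) (n∣m*n p) x q∣x)
                                        , dec-false (p ∣? toℕ x) λ p∣x → ¬both x x≢0 p∣x q∣x)
    where
    to : IsVertex x × divisibleByP x ≡ false → toℕ x ≢ 0 × q ∣ toℕ x
    to (x-vertex , p∤x) with vertex-factor x x-vertex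
    ... | inj₁ (p∣x , _) = ⊥-elim (not-¬ (dec-true (p ∣? toℕ x) p∣x) p∤x)
    ... | inj₂ (q∣x , _) = proj₁ x-vertex , q∣x

  classSize-vertices : ∀ b r → (∀ x → (IsVertex x × divisibleByP x ≡ b) ⇔ (toℕ x ≢ 0 × r ∣ toℕ x)) →
    classSize (divisibleByP ∘ vtx) b ≡ countBelow (nonzero-multiple r) (p * q)
  classSize-vertices b r class⇔ =
    trans (count-lookup-filter isVertex? (λ x → does (divisibleByP x ≟ᵇ b)) id)
          (count-cong λ x → does-⇔ (class⇔ x) (isVertex? x ×-dec (divisibleByP x ≟ᵇ b)) (¬? (toℕ x ≟ 0) ×-dec (r ∣? toℕ x)))

  classSize-p : suc (classSize (divisibleByP ∘ vtx) true) ≡ q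
  classSize-p = begin
    suc (classSize (divisibleByP ∘ vtx) true)        ≡⟨ cong suc (classSize-vertices true p vertex∧p⇔) ⟩
    suc (countBelow (nonzero-multiple p) (p * q))     ≡⟨ countBelow-nonzero p (p * q) (<-trans z<s 1<pq) ⟩
    countBelow (λ i → does (p ∣? i)) (p * q)          ≡⟨ countBelow-multiples p q ⟩
    q                                                 ∎
    where open ≡-Reasoning

  classSize-q : suc (classSize (divisibleByP ∘ vtx) false) ≡ p
  classSize-q = begin
    suc (classSize (divisibleByP ∘ vtx) false)       ≡⟨ cong suc (classSize-vertices false q vertex∧q⇔) ⟩
    suc (countBelow (nonzero-multiple q) (p * q))     ≡⟨ countBelow-nonzero q (p * q) (<-trans z<s 1<pq) ⟩
    countBelow (λ i → does (q ∣? i)) (p * q)          ≡⟨ cong (countBelow (λ i → does (q ∣? i))) (*-comm p q) ⟩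
    countBelow (λ i → does (q ∣? i)) (q * p)          ≡⟨ countBelow-multiples q p ⟩
    p                                                 ∎
    where open ≡-Reasoning

module CozeroDivisorLaplacian (p q : ℕ) (p-prime : Prime p) (q-prime : Prime q) (p≢q : p ≢ q) where
  import Data.Nat as ℕ
  open import Data.Integer using (ℤ; 0ℤ; 1ℤ; -_; _-_)
  import Data.Integer as ℤ using (+_)
  open import Data.Bool using (Bool; true; false; not; if_then_else_)
  open import Data.Bool.Properties using () renaming (_≟_ to _≟ᵇ_)
  open import Data.Fin using (Fin)
  open import Data.Fin.Properties using () renaming (_≟_ to _≟ᶠ_)
  open import Data.List using (allFin)
  import Data.List.Relation.Unary.All as All
  open import Data.List.Relation.Unary.All.Properties using (all-filter)
  open import Data.List.Membership.Propositional.Properties using (∈-lookup)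
  open import Data.Empty using (⊥-elim)
  open import Function using (_∘_; id)
  open import Relation.Nullary using (Dec; yes; no; does)
  open import Data.Product using (_,_)
  open import Relation.Binary.PropositionalEquality
  open Determinant
  open Counting
  open TwoClass
  open SemiprimeResidues p q p-prime q-prime p≢q
  open PrimeDivisors using (1<prime)

  colour : Fin N → Bool
  colour = divisibleByP ∘ vtx

  vtx-vertex : ∀ i → IsVertex (vtx i)
  vtx-vertex i = All.lookup (all-filter isVertex? (allFin (p ℕ.* q))) (∈-lookup i)

  degree≡classSize : ∀ i → degree i ≡ classSize colour (not (colour i))
  degree≡classSize i = trans (length-filter-tabulate (λ j → adj? (vtx i) (vtx j)) id)
    (count-cong λ j → trans (adj?-vertices (vtx i) (vtx j) (vtx-vertex i) (vtx-vertex j)) (other-class (colour i) (colour j)))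
    where
    other-class : ∀ x y → not (does (x ≟ᵇ y)) ≡ does (y ≟ᵇ not x)
    other-class true true = refl
    other-class true false = refl
    other-class false true = refl
    other-class false false = refl

  laplacian-diag : ∀ i → laplacian i i ≡ ℤ.+ degree i
  laplacian-diag i with i ≟ᶠ i
  ... | yes _ = refl
  ... | no i≢i = ⊥-elim (i≢i refl)

  laplacian-off : ∀ {i j} → i ≢ j → laplacian i j ≡ (if does (adj? (vtx i) (vtx j)) then - 1ℤ else 0ℤ)
  laplacian-off {i} {j} i≢j with i ≟ᶠ j
  ... | yes i≡j = ⊥-elim (i≢j i≡j)
  ... | no _ with adj? (vtx i) (vtx j) in adjacency
  ...   | yes _ = cong (λ a → if does a then - 1ℤ else 0ℤ) (sym adjacency)
  ...   | no _ = cong (λ a → if does a then - 1ℤ else 0ℤ) (sym adjacency)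

  diagonal : ℤ → Bool → ℤ
  diagonal t b = t - ℤ.+ classSize colour (not b)

  charPoly≡det-twoClass : ∀ t → charPoly (LaplacianZ (p ℕ.* q)) t ≡ det (twoClass colour (λ _ → 1ℤ) (diagonal t))
  charPoly≡det-twoClass t = trans (charPoly-scalarMat laplacian t) (det-cong λ i j → entry i j (i ≟ᶠ j))
    where
    flip-sign : ∀ s → 0ℤ - (if not s then - 1ℤ else 0ℤ) ≡ (if s then 0ℤ else 1ℤ)
    flip-sign true = refl
    flip-sign false = refl
    entry : ∀ i j → Dec (i ≡ j) → scalarMat t i j - laplacian i j ≡ twoClass colour (λ _ → 1ℤ) (diagonal t) i j
    entry i .i (yes refl) =
      trans (cong₂ _-_ (scalarMat-diag t i) (trans (laplacian-diag i) (cong ℤ.+_ (degree≡classSize i))))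
            (sym (twoClass-diag colour _ _ i))
    entry i j (no i≢j) =
      trans (cong₂ _-_ (scalarMat-off t i≢j)
                       (trans (laplacian-off i≢j)
                              (cong (λ a → if a then - 1ℤ else 0ℤ) (adj?-vertices (vtx i) (vtx j) (vtx-vertex i) (vtx-vertex j)))))
            (trans (flip-sign (does (colour i ≟ᵇ colour j))) (sym (twoClass-off colour _ _ i j i≢j)))

  open CompleteBipartiteSpectrum

  charPoly-spectrum : ∀ t → charPoly (LaplacianZ (p ℕ.* q)) t ≡ spectrumPolynomial p q t
  charPoly-spectrum t = begin
    charPoly (LaplacianZ (p ℕ.* q)) t                        ≡⟨ charPoly≡det-twoClass t ⟩
    det (twoClass colour (λ _ → 1ℤ) (diagonal t))            ≡⟨ det-twoClass colour (λ _ → 1ℤ) (diagonal t) true ⟩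
    twoClassDet colour (λ _ → 1ℤ) (diagonal t) true
      ≡⟨ bipartiteDet-cong {k = k} {m = m} refl refl (classWeight-1 colour true) (classWeight-1 colour false) _ _ ⟩
    bipartiteDet k m (ℤ.+ k) (ℤ.+ m) (t - ℤ.+ m) (t - ℤ.+ k)
      ≡⟨ bipartiteDet-spectrum (1<prime p-prime) (1<prime q-prime) classSize-p classSize-q t ⟩
    spectrumPolynomial p q t                                 ∎
    where
    open ≡-Reasoning
    k = classSize colour true
    m = classSize colour false

  laplacian-integral : LaplacianIntegral (p ℕ.* q)
  laplacian-integral =
    eigenvalues p q ,
    trans (length-eigenvalues (1<prime p-prime) (1<prime q-prime) classSize-p classSize-q) (classSize-total colour) ,
    λ t → trans (charPoly-spectrum t) (sym (∏-eigenvalues p q t))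

open import Data.Nat using (_+_; _*_; _∸_)
open import Data.Integer as ℤ using (ℤ; +_; _-_; _^_)
open import Data.Product using (_×_; _,_)
open import Relation.Binary.PropositionalEquality using (_≡_)

mainTheorem6 : (p q : ℕ) (pp : Prime p) (qp : Prime q) → p ≢ q →
    (∀ (t : ℤ) → charPoly (LaplacianZ (p * q) {{nonZeroPQ pp qp}}) t
        ≡ t ℤ.* (t - + (p + q ∸ 2)) ℤ.* ((t - + (p ∸ 1)) ^ (q ∸ 2)) ℤ.* ((t - + (q ∸ 1)) ^ (p ∸ 2)))
    × LaplacianIntegral (p * q) {{nonZeroPQ pp qp}}
mainTheorem6 p q pp qp p≢q = charPoly-spectrum , laplacian-integral
  where open CozeroDivisorLaplacian p q pp qp p≢q
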